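{- Let $n\geq2$ be an integer, let $p$ be an odd prime, and let $q=2p$. Then \[|\mathcal{O}(n,q)|=\frac{1+(-1)^n}{2}\binom{p+\lfloor n/2\rfloor-2}{\lfloor n/2\rfloor-1}+\sum_{\substack{2s+pt=n\\ s\geq1,\,t\geq1}}\binom{p+s-1}{s}+\sum_{\substack{2s+pt=n\\ s\geq1,\,t\geq1}}\binom{p+s-2}{s-1}+\delta,\] where the sums run over integers $s,t\geq1$ with $2s+pt=n$, and $\delta=1$ if $p$ divides $n$ and $\delta=0$ otherwise.
   Context: $\mathbb{Z}_q$ is the additive group of integers modulo $q$ with underlying set $\{0,\dots,q-1\}$; $\mathbb{Z}_q^n$ is linearly ordered by $\prec$, where $a\prec b$ iff $a=b$ or $a$ lexicographically precedes $b$ (comparing coordinates as integers in $\{0,\dots,q-1\}$). For $x\in\mathbb{Z}_q^n$, $\mathrm{Sort}(x)$ is the $\prec$-minimum of all coordinate permutations of $x$ (i.e. $x$ with coordinates in nondecreasing order). The evaluation function is $\mathcal{E}_{n,q}(x)=\sum_{i=1}^n\exp(2\pi\mathbf{i}x_i/q)$. Define $\mathcal{O}(n,q):=\{x\in\mathbb{Z}_q^n\colon x_1=0,\ x=\mathrm{Sort}(x),\ \mathcal{E}_{n,q}(x)=0\}$. -}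

module Defs where

open import Level using (Level; _⊔_)
open import Algebra.Bundles using (CommutativeRing)
open import Data.Nat as Nat using (ℕ; zero; suc)
open import Data.Nat.Divisibility using (_∣?_)
open import Data.Nat.Combinatorics using (_C_)
open import Data.Fin using (Fin; toℕ)
open import Data.Fin.Properties using (≤-totalOrder)
open import Data.Vec using (Vec; toList; head)
open import Data.List as List using (List; []; _∷_; upTo; concatMap; length)
open import Data.Nat.ListAction using (sum)
open import Data.List.Relation.Unary.Unique.Propositional using (Unique)
open import Data.List.Membership.Propositional using (_∈_)
open import Data.List.Relation.Unary.Sorted.TotalOrder using (Sorted)
open import Data.Product using (Σ; _×_)
open import Function.Bundles using (_⇔_)
open import Relation.Nullary using (¬_)
open import Relation.Nullary.Decidable using (does)
open import Relation.Binary.PropositionalEquality using (_≡_)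
open import Data.Empty using (⊥)
open import Data.Bool using (if_then_else_)

module RingOps {c ℓ : Level} (R : CommutativeRing c ℓ) where
  open CommutativeRing R
  natToCarrier : ℕ → Carrier
  natToCarrier zero = 0#
  natToCarrier (suc m) = 1# + natToCarrier m
  pow : Carrier → ℕ → Carrier
  pow x zero = 1#
  pow x (suc k) = x * pow x k

record CharZeroField (c ℓ : Level) : Set (Level.suc (c ⊔ ℓ)) where
  field
    commRing : CommutativeRing c ℓ
  open CommutativeRing commRing public
  open RingOps commRing public
  field
    1≉0      : ¬ (1# ≈ 0#)
    inverse  : ∀ x → ¬ (x ≈ 0#) → Σ Carrier (λ y → x * y ≈ 1#)
    charZero : ∀ m → ¬ (natToCarrier (suc m) ≈ 0#)

FirstZero : ∀ {q} → List (Fin q) → Set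
FirstZero [] = ⊥
FirstZero (a ∷ _) = toℕ a ≡ 0

module _ {c ℓ : Level} (F : CharZeroField c ℓ) where
  open CharZeroField F

  IsPrimitiveRoot : ℕ → Carrier → Set ℓ
  IsPrimitiveRoot q ζ = (pow ζ q ≈ 1#) × (∀ k → 0 Nat.< k → k Nat.< q → ¬ (pow ζ k ≈ 1#))

  -- Evaluation function E_{n,q}(x) = Σ_i ζ^{x_i}  (ζ playing exp(2πi/q))
  evalE : ∀ {q n} → Carrier → Vec (Fin q) n → Carrier
  evalE ζ x = List.foldr (λ a acc → pow ζ (toℕ a) + acc) 0# (toList x)

  -- membership in O(n,q): x₁ = 0, x = Sort(x) (i.e. nondecreasing), E(x) = 0
  InO : ∀ {q n} → Carrier → Vec (Fin q) n → Set ℓ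
  InO {q} ζ x = FirstZero (toList x) × Sorted (≤-totalOrder q) (toList x) × (evalE ζ x ≈ 0#)

HasCard : ∀ {a p} {A : Set a} → (A → Set p) → ℕ → Set (a ⊔ p)
HasCard {A = A} P k =
  Σ (List A) λ L → Unique L × (∀ x → (x ∈ L) ⇔ P x) × (length L ≡ k)

open Nat using (_+_; _*_; _∸_; _/_; _%_)

oneTo : ℕ → List ℕ
oneTo m = List.map suc (upTo m)

-- Σ_{s,t ≥ 1, 2s + p t = n} f s   (s, t ≤ n necessarily)
sumST : ℕ → ℕ → (ℕ → ℕ) → ℕ
sumST n p f = sum (concatMap (λ s → concatMap (λ t →
  if does (2 * s + p * t Nat.≟ n) then f s ∷ [] else []) (oneTo n)) (oneTo n))

-- (1 + (-1)^n)/2, i.e. 1 if n is even, 0 if n is odd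
parityFactor : ℕ → ℕ
parityFactor n = 1 ∸ (n % 2)

delta : ℕ → ℕ → ℕ
delta p n = if does (p ∣? n) then 1 else 0

rhs : ℕ → ℕ → ℕ
rhs n p =
  parityFactor n * ((p + n / 2 ∸ 2) C (n / 2 ∸ 1))
  + sumST n p (λ s → (p + s ∸ 1) C s)
  + sumST n p (λ s → (p + s ∸ 2) C (s ∸ 1))
  + delta p n

-- A sorted x ∈ O(n, 2p) is determined by its multiplicity vector, split into halves u, v ∈ ℕ^p (residues
-- below p and from p on). As ζ^p = -1 and ξ = -ζ is a primitive p-th root of unity, E(x) equals
-- Σ (-1)^k (u_k - v_k) ξ^k, and since 1, ξ, …, ξ^(p-2) are linearly independent over ℚ (Eisenstein's
-- criterion for the p-th cyclotomic polynomial in ξ - 1), E(x) = 0 iff u - v = C (1, -1, 1, …) for an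
-- integer C. Sorting the solutions by the sign of C and counting weak compositions gives the formula.

module Submission where

open import Level using (Level)
open import Defs
import Data.Nat as ℕ
open import Data.Nat.Primality using (Prime)
open import Data.Nat.Divisibility using () renaming (_∣_ to _∣ℕ_)
open import Relation.Nullary using (¬_)

module Preliminaries where

  open import Data.Nat as ℕ using (ℕ; zero; suc; _<_; z≤n; s≤s)
  import Data.Nat.Properties as ℕP
  open import Data.Nat.Divisibility using (divides) renaming (_∣_ to _∣ℕ_)
  open import Data.Integer as ℤ using (ℤ; +_; _*_; _-_; -_; 1ℤ)
  import Data.Integer.Properties as ℤP
  open import Data.Integer.Tactic.RingSolver using (solve-∀)
  open import Data.List using (List; []; _∷_; length)
  open import Data.Product using (_×_; _,_)
  open import Data.Sum using (_⊎_; inj₁; inj₂)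
  open import Data.Empty using (⊥-elim)
  open import Relation.Nullary using (¬_)
  open import Relation.Binary.PropositionalEquality using (_≡_; refl; cong; cong₂; sym; trans)

  nth : List ℕ → ℕ → ℕ
  nth [] _ = 0
  nth (x ∷ xs) zero = x
  nth (x ∷ xs) (suc k) = nth xs k

  nth-ext : ∀ x y → length x ≡ length y → (∀ k → k < length x → nth x k ≡ nth y k) → x ≡ y
  nth-ext [] [] _ _ = refl
  nth-ext (a ∷ x) (b ∷ y) l h = cong₂ _∷_ (h 0 (s≤s z≤n)) (nth-ext x y (ℕP.suc-injective l) (λ k lt → h (suc k) (s≤s lt)))

  altSign : ℕ → ℤ
  altSign zero = 1ℤ
  altSign (suc n) = - altSign n

  altSign-parity : ∀ n → (altSign n ≡ 1ℤ × 2 ∣ℕ n) ⊎ (altSign n ≡ - 1ℤ × 2 ∣ℕ suc n)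
  altSign-parity zero = inj₁ (refl , divides 0 refl)
  altSign-parity (suc n) with altSign-parity n
  ... | inj₁ (s , divides q e) = inj₂ (cong -_ s , divides (suc q) (cong (λ w → suc (suc w)) e))
  ... | inj₂ (s , d) = inj₁ (cong -_ s , d)

  altSign-odd : ∀ n → ¬ 2 ∣ℕ n → altSign n ≡ - 1ℤ
  altSign-odd n nd with altSign-parity n
  ... | inj₁ (_ , d) = ⊥-elim (nd d)
  ... | inj₂ (s , _) = s

  altSign-square : ∀ k → altSign k * altSign k ≡ + 1
  altSign-square zero = refl
  altSign-square (suc k) = trans (neg*neg (altSign k)) (altSign-square k)
    where
    neg*neg : ∀ a → - a * - a ≡ a * a
    neg*neg = solve-∀

  altSign-involutive : ∀ k x → altSign k * (altSign k * x) ≡ x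
  altSign-involutive k x = trans (sym (ℤP.*-assoc (altSign k) (altSign k) x))
                                 (trans (cong (_* x) (altSign-square k)) (ℤP.*-identityˡ x))

  AlternatingDifference : ℕ → List ℕ → List ℕ → ℤ → Set
  AlternatingDifference p u v C = ∀ k → k < p → + nth u k - + nth v k ≡ altSign k * C

module IntegerPolynomial where

  open import Data.Nat as ℕ using (ℕ; zero; suc; _≤_; _<_; z≤n; s≤s)
  import Data.Nat.Properties as ℕP
  open import Data.Integer as ℤ using (ℤ; +_; _+_; _*_; -_; 0ℤ; 1ℤ)
  import Data.Integer.Properties as ℤP
  open import Data.Integer.Tactic.RingSolver using (solve-∀)
  open import Data.List using (List; []; _∷_; map; length)
  open import Data.Product using (Σ; _×_; _,_; proj₂)
  open import Data.Sum using (_⊎_; inj₁; inj₂)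
  open import Data.Empty using (⊥-elim)
  open import Relation.Nullary using (¬_; yes; no)
  open import Relation.Binary.Definitions using (tri<; tri≈; tri>)
  open import Relation.Binary.PropositionalEquality using (_≡_; refl; cong; cong₂; sym; trans)
  open import Relation.Binary.PropositionalEquality.Properties using (module ≡-Reasoning)
  open ≡-Reasoning

  cong+ˡ : ∀ x {y z} → y ≡ z → x + y ≡ x + z
  cong+ˡ x e = cong (λ w → x + w) e

  -- Coefficient lists, constant term first; _≋_ compares coefficientwise, so trailing zeros are irrelevant.
  Poly : Set
  Poly = List ℤ

  coeff : Poly → ℕ → ℤ
  coeff [] _ = 0ℤ
  coeff (a ∷ f) zero = a
  coeff (a ∷ f) (suc i) = coeff f i

  infix 4 _≋_
  record _≋_ (f g : Poly) : Set where
    constructor mk≋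
    field at : ∀ i → coeff f i ≡ coeff g i
  open _≋_ public

  ≋-refl : ∀ {f} → f ≋ f
  ≋-refl = mk≋ λ i → refl
  ≋-sym : ∀ {f g} → f ≋ g → g ≋ f
  ≋-sym e = mk≋ λ i → sym (at e i)
  ≋-trans : ∀ {f g h} → f ≋ g → g ≋ h → f ≋ h
  ≋-trans e e' = mk≋ λ i → trans (at e i) (at e' i)

  infixl 6 _⊕_
  _⊕_ : Poly → Poly → Poly
  [] ⊕ g = g
  (a ∷ f) ⊕ [] = a ∷ f
  (a ∷ f) ⊕ (b ∷ g) = (a + b) ∷ (f ⊕ g)

  coeff-⊕ : ∀ f g i → coeff (f ⊕ g) i ≡ coeff f i + coeff g i
  coeff-⊕ [] g i = sym (ℤP.+-identityˡ _)
  coeff-⊕ (a ∷ f) [] i = sym (ℤP.+-identityʳ _)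
  coeff-⊕ (a ∷ f) (b ∷ g) zero = refl
  coeff-⊕ (a ∷ f) (b ∷ g) (suc i) = coeff-⊕ f g i

  scale : ℤ → Poly → Poly
  scale c = map (c *_)

  coeff-scale : ∀ c f i → coeff (scale c f) i ≡ c * coeff f i
  coeff-scale c [] i = sym (ℤP.*-zeroʳ c)
  coeff-scale c (a ∷ f) zero = refl
  coeff-scale c (a ∷ f) (suc i) = coeff-scale c f i

  infixl 7 _⊛_
  _⊛_ : Poly → Poly → Poly
  [] ⊛ g = []
  (a ∷ f) ⊛ g = scale a g ⊕ (0ℤ ∷ (f ⊛ g))

  coeff-⊛-0 : ∀ f g → coeff (f ⊛ g) 0 ≡ coeff f 0 * coeff g 0
  coeff-⊛-0 [] g = refl
  coeff-⊛-0 (a ∷ f) g = trans (coeff-⊕ (scale a g) (0ℤ ∷ (f ⊛ g)) 0) (trans (ℤP.+-identityʳ _) (coeff-scale a g 0))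

  coeff-⊛-suc : ∀ a f g i → coeff ((a ∷ f) ⊛ g) (suc i) ≡ a * coeff g (suc i) + coeff (f ⊛ g) i
  coeff-⊛-suc a f g i = trans (coeff-⊕ (scale a g) (0ℤ ∷ (f ⊛ g)) (suc i)) (cong (_+ coeff (f ⊛ g) i) (coeff-scale a g (suc i)))

  coeff-⊛∷ : ∀ a f g i → coeff ((a ∷ f) ⊛ g) i ≡ a * coeff g i + coeff (0ℤ ∷ (f ⊛ g)) i
  coeff-⊛∷ a f g i = trans (coeff-⊕ (scale a g) (0ℤ ∷ (f ⊛ g)) i) (cong (_+ coeff (0ℤ ∷ (f ⊛ g)) i) (coeff-scale a g i))

  coeff-⊛-∷ʳ : ∀ f b g i → coeff (f ⊛ (b ∷ g)) i ≡ coeff (scale b f ⊕ (0ℤ ∷ (f ⊛ g))) i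
  coeff-⊛-∷ʳ [] b g zero = refl
  coeff-⊛-∷ʳ [] b g (suc i) = refl
  coeff-⊛-∷ʳ (a ∷ f) b g zero = begin
    coeff ((a ∷ f) ⊛ (b ∷ g)) 0 ≡⟨ coeff-⊛-0 (a ∷ f) (b ∷ g) ⟩
    a * b ≡⟨ trans (ℤP.*-comm a b) (sym (ℤP.+-identityʳ _)) ⟩
    b * a + 0ℤ ∎
  coeff-⊛-∷ʳ (a ∷ f) b g (suc i) = begin
    coeff ((a ∷ f) ⊛ (b ∷ g)) (suc i) ≡⟨ coeff-⊛-suc a f (b ∷ g) i ⟩
    a * coeff g i + coeff (f ⊛ (b ∷ g)) i ≡⟨ cong+ˡ (a * coeff g i) (coeff-⊛-∷ʳ f b g i) ⟩
    a * coeff g i + coeff (scale b f ⊕ (0ℤ ∷ (f ⊛ g))) i ≡⟨ cong+ˡ (a * coeff g i) (coeff-⊕ (scale b f) _ i) ⟩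
    a * coeff g i + (coeff (scale b f) i + coeff (0ℤ ∷ (f ⊛ g)) i)
        ≡⟨ cong (λ z → a * coeff g i + (z + coeff (0ℤ ∷ (f ⊛ g)) i)) (coeff-scale b f i) ⟩
    a * coeff g i + (b * coeff f i + coeff (0ℤ ∷ (f ⊛ g)) i) ≡⟨ lem (a * coeff g i) (b * coeff f i) (coeff (0ℤ ∷ (f ⊛ g)) i) ⟩
    b * coeff f i + (a * coeff g i + coeff (0ℤ ∷ (f ⊛ g)) i) ≡⟨ cong+ˡ (b * coeff f i) (sym (coeff-⊛∷ a f g i)) ⟩
    b * coeff f i + coeff ((a ∷ f) ⊛ g) i ≡⟨ cong (_+ coeff ((a ∷ f) ⊛ g) i) (sym (coeff-scale b (a ∷ f) (suc i))) ⟩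
    coeff (scale b (a ∷ f)) (suc i) + coeff (0ℤ ∷ ((a ∷ f) ⊛ g)) (suc i) ≡⟨ sym (coeff-⊕ (scale b (a ∷ f)) (0ℤ ∷ ((a ∷ f) ⊛ g)) (suc i)) ⟩
    coeff (scale b (a ∷ f) ⊕ (0ℤ ∷ ((a ∷ f) ⊛ g))) (suc i) ∎
    where
    lem : ∀ x y z → x + (y + z) ≡ y + (x + z)
    lem = solve-∀

  ⊛-∷ʳ : ∀ f b g → f ⊛ (b ∷ g) ≋ scale b f ⊕ (0ℤ ∷ (f ⊛ g))
  ⊛-∷ʳ f b g = mk≋ (coeff-⊛-∷ʳ f b g)

  ∷-cong : ∀ {a b f g} → a ≡ b → f ≋ g → (a ∷ f) ≋ (b ∷ g)
  ∷-cong e e' = mk≋ λ { zero → e ; (suc i) → at e' i }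

  ≋-tail : ∀ {a b f g} → (a ∷ f) ≋ (b ∷ g) → f ≋ g
  ≋-tail e = mk≋ λ i → at e (suc i)

  ≋[]-tail : ∀ {a f} → (a ∷ f) ≋ [] → f ≋ []
  ≋[]-tail e = mk≋ λ i → at e (suc i)

  ⊕-cong : ∀ {f f' g g'} → f ≋ f' → g ≋ g' → f ⊕ g ≋ f' ⊕ g'
  ⊕-cong {f} {f'} {g} {g'} e e' = mk≋ λ i → trans (coeff-⊕ f g i) (trans (cong₂ _+_ (at e i) (at e' i)) (sym (coeff-⊕ f' g' i)))

  scale-cong : ∀ {c d f g} → c ≡ d → f ≋ g → scale c f ≋ scale d g
  scale-cong {c} {d} {f} {g} e e' = mk≋ λ i → trans (coeff-scale c f i) (trans (cong₂ _*_ e (at e' i)) (sym (coeff-scale d g i)))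

  ⊕-comm : ∀ f g → f ⊕ g ≋ g ⊕ f
  ⊕-comm f g = mk≋ λ i → trans (coeff-⊕ f g i) (trans (ℤP.+-comm (coeff f i) (coeff g i)) (sym (coeff-⊕ g f i)))

  ⊕-assoc : ∀ f g h → (f ⊕ g) ⊕ h ≋ f ⊕ (g ⊕ h)
  ⊕-assoc f g h = mk≋ λ i → begin
    coeff ((f ⊕ g) ⊕ h) i ≡⟨ coeff-⊕ (f ⊕ g) h i ⟩
    coeff (f ⊕ g) i + coeff h i ≡⟨ cong (λ z → z + coeff h i) (coeff-⊕ f g i) ⟩
    coeff f i + coeff g i + coeff h i ≡⟨ ℤP.+-assoc (coeff f i) (coeff g i) (coeff h i) ⟩
    coeff f i + (coeff g i + coeff h i) ≡⟨ cong+ˡ (coeff f i) (sym (coeff-⊕ g h i)) ⟩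
    coeff f i + coeff (g ⊕ h) i ≡⟨ sym (coeff-⊕ f (g ⊕ h) i) ⟩
    coeff (f ⊕ (g ⊕ h)) i ∎

  ⊕-interchange : ∀ a b c d → (a ⊕ b) ⊕ (c ⊕ d) ≋ (a ⊕ c) ⊕ (b ⊕ d)
  ⊕-interchange a b c d = mk≋ λ i → begin
    coeff ((a ⊕ b) ⊕ (c ⊕ d)) i ≡⟨ coeff-⊕ (a ⊕ b) (c ⊕ d) i ⟩
    coeff (a ⊕ b) i + coeff (c ⊕ d) i ≡⟨ cong₂ _+_ (coeff-⊕ a b i) (coeff-⊕ c d i) ⟩
    (coeff a i + coeff b i) + (coeff c i + coeff d i) ≡⟨ lem (coeff a i) (coeff b i) (coeff c i) (coeff d i) ⟩
    (coeff a i + coeff c i) + (coeff b i + coeff d i) ≡⟨ sym (cong₂ _+_ (coeff-⊕ a c i) (coeff-⊕ b d i)) ⟩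
    coeff (a ⊕ c) i + coeff (b ⊕ d) i ≡⟨ sym (coeff-⊕ (a ⊕ c) (b ⊕ d) i) ⟩
    coeff ((a ⊕ c) ⊕ (b ⊕ d)) i ∎
    where
    lem : ∀ w x y z → (w + x) + (y + z) ≡ (w + y) + (x + z)
    lem = solve-∀

  ⊕-identityʳ : ∀ f → f ⊕ [] ≋ f
  ⊕-identityʳ f = mk≋ λ i → trans (coeff-⊕ f [] i) (ℤP.+-identityʳ _)

  ⊕-zero∷ : ∀ f → f ⊕ (0ℤ ∷ []) ≋ f
  ⊕-zero∷ f = mk≋ λ { zero → trans (coeff-⊕ f (0ℤ ∷ []) 0) (ℤP.+-identityʳ _) ; (suc i) → trans (coeff-⊕ f (0ℤ ∷ []) (suc i)) (ℤP.+-identityʳ _) }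

  scale-⊕ : ∀ c f g → scale c (f ⊕ g) ≋ scale c f ⊕ scale c g
  scale-⊕ c f g = mk≋ λ i → begin
    coeff (scale c (f ⊕ g)) i ≡⟨ coeff-scale c (f ⊕ g) i ⟩
    c * coeff (f ⊕ g) i ≡⟨ cong (c *_) (coeff-⊕ f g i) ⟩
    c * (coeff f i + coeff g i) ≡⟨ ℤP.*-distribˡ-+ c _ _ ⟩
    c * coeff f i + c * coeff g i ≡⟨ sym (cong₂ _+_ (coeff-scale c f i) (coeff-scale c g i)) ⟩
    coeff (scale c f) i + coeff (scale c g) i ≡⟨ sym (coeff-⊕ (scale c f) (scale c g) i) ⟩
    coeff (scale c f ⊕ scale c g) i ∎

  scale-scale : ∀ a b f → scale a (scale b f) ≋ scale (a * b) f
  scale-scale a b f = mk≋ λ i → trans (coeff-scale a (scale b f) i)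
      (trans (cong (a *_) (coeff-scale b f i)) (trans (sym (ℤP.*-assoc a b (coeff f i))) (sym (coeff-scale (a * b) f i))))

  scale-1 : ∀ f → scale 1ℤ f ≋ f
  scale-1 f = mk≋ λ i → trans (coeff-scale 1ℤ f i) (ℤP.*-identityˡ _)

  scale-0 : ∀ f → scale 0ℤ f ≋ []
  scale-0 f = mk≋ λ i → trans (coeff-scale 0ℤ f i) (ℤP.*-zeroˡ (coeff f i))

  ⊛-zeroˡ : ∀ f g → f ≋ [] → f ⊛ g ≋ []
  ⊛-zeroˡ [] g e = ≋-refl
  ⊛-zeroˡ (a ∷ f) g e = ≋-trans (⊕-cong (≋-trans (scale-cong (at e 0) ≋-refl) (scale-0 g)) (∷-cong refl (⊛-zeroˡ f g (≋[]-tail e)))) lem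
    where
    lem : [] ⊕ (0ℤ ∷ []) ≋ []
    lem = mk≋ λ { zero → refl ; (suc i) → refl }

  ⊛-congˡ : ∀ {f f'} g → f ≋ f' → f ⊛ g ≋ f' ⊛ g
  ⊛-congˡ {[]} {[]} g e = ≋-refl
  ⊛-congˡ {[]} {b ∷ f'} g e = ≋-sym (⊛-zeroˡ (b ∷ f') g (≋-sym e))
  ⊛-congˡ {a ∷ f} {[]} g e = ⊛-zeroˡ (a ∷ f) g e
  ⊛-congˡ {a ∷ f} {b ∷ f'} g e = ⊕-cong (scale-cong (at e 0) ≋-refl) (∷-cong refl (⊛-congˡ g (≋-tail e)))

  ⊛-congʳ : ∀ f {g g'} → g ≋ g' → f ⊛ g ≋ f ⊛ g'
  ⊛-congʳ [] e = ≋-refl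
  ⊛-congʳ (a ∷ f) e = ⊕-cong (scale-cong {a} refl e) (∷-cong refl (⊛-congʳ f e))

  ⊛-⊕ʳ : ∀ f g h → f ⊛ (g ⊕ h) ≋ f ⊛ g ⊕ f ⊛ h
  ⊛-⊕ʳ [] g h = ≋-refl
  ⊛-⊕ʳ (a ∷ f) g h = ≋-trans (⊕-cong (scale-⊕ a g h) (∷-cong refl (⊛-⊕ʳ f g h)))
    (⊕-interchange (scale a g) (scale a h) (0ℤ ∷ (f ⊛ g)) (0ℤ ∷ (f ⊛ h)))


  ⊛-scaleʳ : ∀ f c g → f ⊛ scale c g ≋ scale c (f ⊛ g)
  ⊛-scaleʳ [] c g = ≋-refl
  ⊛-scaleʳ (a ∷ f) c g = ≋-trans (⊕-cong (≋-trans (scale-scale a c g) (≋-trans (scale-cong (ℤP.*-comm a c) ≋-refl) (≋-sym (scale-scale c a g))))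
                                      (∷-cong (sym (ℤP.*-zeroʳ c)) (⊛-scaleʳ f c g)))
                      (≋-sym (scale-⊕ c (scale a g) (0ℤ ∷ (f ⊛ g))))

  ⊛-scaleˡ : ∀ c f g → scale c f ⊛ g ≋ scale c (f ⊛ g)
  ⊛-scaleˡ c [] g = ≋-refl
  ⊛-scaleˡ c (a ∷ f) g = ≋-trans (⊕-cong (≋-sym (scale-scale c a g)) (∷-cong (sym (ℤP.*-zeroʳ c)) (⊛-scaleˡ c f g)))
                                  (≋-sym (scale-⊕ c (scale a g) (0ℤ ∷ (f ⊛ g))))

  ⊛-X : ∀ f g → f ⊛ (0ℤ ∷ g) ≋ 0ℤ ∷ (f ⊛ g)
  ⊛-X f g = ≋-trans (⊛-∷ʳ f 0ℤ g) (mk≋ λ i → trans (coeff-⊕ (scale 0ℤ f) _ i)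
      (trans (cong (_+ coeff (0ℤ ∷ (f ⊛ g)) i) (at (scale-0 f) i)) (ℤP.+-identityˡ _)))

  ⊛-zeroʳ : ∀ f → f ⊛ [] ≋ []
  ⊛-zeroʳ [] = ≋-refl
  ⊛-zeroʳ (a ∷ f) = ≋-trans (∷-cong refl (⊛-zeroʳ f)) lem
    where
    lem : (0ℤ ∷ []) ≋ []
    lem = mk≋ λ { zero → refl ; (suc i) → refl }



  DegreeBelow : ℕ → Poly → Set
  DegreeBelow n f = ∀ i → n ≤ i → coeff f i ≡ 0ℤ

  DegreeBelow-≋ : ∀ {n f g} → f ≋ g → DegreeBelow n f → DegreeBelow n g
  DegreeBelow-≋ e b i le = trans (sym (at e i)) (b i le)

  DegreeBelow-⊕ : ∀ {n} f g → DegreeBelow n f → DegreeBelow n g → DegreeBelow n (f ⊕ g)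
  DegreeBelow-⊕ f g bf bg i le = trans (coeff-⊕ f g i) (cong₂ _+_ (bf i le) (bg i le))

  DegreeBelow-scale : ∀ {n} c f → DegreeBelow n f → DegreeBelow n (scale c f)
  DegreeBelow-scale c f bf i le = trans (coeff-scale c f i) (trans (cong (c *_) (bf i le)) (ℤP.*-zeroʳ c))

  DegreeBelow-mono : ∀ {n m f} → n ≤ m → DegreeBelow n f → DegreeBelow m f
  DegreeBelow-mono nm b i le = b i (ℕP.≤-trans nm le)

  DegreeBelow-len : ∀ f → DegreeBelow (length f) f
  DegreeBelow-len [] i le = refl
  DegreeBelow-len (a ∷ f) (suc i) (s≤s le) = DegreeBelow-len f i le

  DegreeBelow-∷ : ∀ {n a f} → DegreeBelow n f → DegreeBelow (suc n) (a ∷ f)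
  DegreeBelow-∷ b (suc i) (s≤s le) = b i le

  DegreeBelow-tail : ∀ {n a f} → DegreeBelow (suc n) (a ∷ f) → DegreeBelow n f
  DegreeBelow-tail b i le = b (suc i) (s≤s le)

  DegreeBelow-0 : ∀ {f} → DegreeBelow 0 f → f ≋ []
  DegreeBelow-0 b = mk≋ λ i → b i z≤n

  DegreeBelow-lower : ∀ {d f} → DegreeBelow (suc d) f → coeff f d ≡ 0ℤ → DegreeBelow d f
  DegreeBelow-lower bz lead≡0 i d≤i with ℕP.m≤n⇒m<n∨m≡n d≤i
  ... | inj₁ d<i = bz i d<i
  ... | inj₂ refl = lead≡0

  Degree : ℕ → Poly → Set
  Degree k f = (¬ coeff f k ≡ 0ℤ) × DegreeBelow (suc k) f

  degree? : ∀ f → f ≋ [] ⊎ Σ ℕ (λ k → Degree k f)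
  degree? [] = inj₁ ≋-refl
  degree? (a ∷ f) with degree? f
  ... | inj₂ (k , ne , bz) = inj₂ (suc k , ne , DegreeBelow-∷ bz)
  ... | inj₁ e with a ℤ.≟ 0ℤ
  ...   | yes a0 = inj₁ (mk≋ λ { zero → a0 ; (suc i) → at e i })
  ...   | no a≠0 = inj₂ (0 , a≠0 , λ { (suc i) _ → at e i })

  Degree-unique : ∀ {k k' f} → Degree k f → Degree k' f → k ≡ k'
  Degree-unique {k} {k'} (ne , bz) (ne' , bz') with ℕP.<-cmp k k'
  ... | tri< lt _ _ = ⊥-elim (ne' (bz k' lt))
  ... | tri≈ _ e _ = e
  ... | tri> _ _ gt = ⊥-elim (ne (bz' k gt))

  Degree-≋ : ∀ {k f g} → f ≋ g → Degree k f → Degree k g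
  Degree-≋ e (ne , bz) = (λ z → ne (trans (at e _) z)) , DegreeBelow-≋ e bz

  Degree-⊕ : ∀ {k m} A B → Degree k A → DegreeBelow m B → m ≤ k → Degree k (B ⊕ A)
  Degree-⊕ {k} A B (ne , bz) bB mk = (λ z → ne
      (trans (sym (ℤP.+-identityˡ (coeff A k))) (trans (cong (_+ coeff A k) (sym (bB k mk))) (trans (sym (coeff-⊕ B A k)) z))))
    , DegreeBelow-⊕ B A (DegreeBelow-mono {f = B} (ℕP.≤-trans mk (ℕP.n≤1+n k)) bB) bz

  *-nonzero : ∀ a b → ¬ a ≡ 0ℤ → ¬ b ≡ 0ℤ → ¬ a * b ≡ 0ℤ
  *-nonzero a b na nb e with ℤP.i*j≡0⇒i≡0∨j≡0 a e
  ... | inj₁ x = na x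
  ... | inj₂ y = nb y

  Degree-scale : ∀ {k f} c → ¬ c ≡ 0ℤ → Degree k f → Degree k (scale c f)
  Degree-scale {k} {f} c nc (ne , bz) = (λ z → *-nonzero c (coeff f k) nc ne (trans (sym (coeff-scale c f k)) z)) , DegreeBelow-scale c f bz

  Degree-X* : ∀ {k f} → Degree k f → Degree (suc k) (0ℤ ∷ f)
  Degree-X* (ne , bz) = ne , DegreeBelow-∷ bz

  Degree-⊛ : ∀ F U i j → Degree i F → Degree j U → Degree (i ℕ.+ j) (F ⊛ U)
  Degree-⊛ [] U i j (ne , _) hU = ⊥-elim (ne refl)
  Degree-⊛ (a ∷ F) U zero j (ne , bz) hU =
    Degree-≋ (≋-sym (≋-trans (⊕-cong (≋-refl {scale a U}) (∷-cong refl (⊛-zeroˡ F U (DegreeBelow-0 (DegreeBelow-tail bz)))))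
        (⊕-zero∷ (scale a U)))) (Degree-scale {f = U} a ne hU)
  Degree-⊛ (a ∷ F) U (suc i) j (ne , bz) hU@(_ , bzU) =
    Degree-⊕ (0ℤ ∷ (F ⊛ U)) (scale a U) (Degree-X* (Degree-⊛ F U i j (ne , DegreeBelow-tail bz) hU))
        (DegreeBelow-scale a U bzU) (s≤s (ℕP.m≤n+m j i))

  index≤degree : ∀ {k f i} → DegreeBelow (suc k) f → ¬ coeff f i ≡ 0ℤ → i ≤ k
  index≤degree {k} {f} {i} bz ne with ℕP.≤-<-connex i k
  ... | inj₁ le = le
  ... | inj₂ lt = ⊥-elim (ne (bz i lt))

  module PseudoDivision (F : Poly) (d' : ℕ) (hF : Degree (suc d') F) where
    a : ℤ
    a = coeff F (suc d')

    pseudoDivide : ∀ G → Σ ℕ λ k → Σ Poly λ U → Σ Poly λ R → (scale (a ℤ.^ k) G ≋ F ⊛ U ⊕ R) × DegreeBelow (suc d') R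
    pseudoDivide [] = 0 , [] , [] , ≋-sym (≋-trans (⊕-identityʳ (F ⊛ [])) (⊛-zeroʳ F)) , λ i _ → refl
    pseudoDivide (c ∷ G') with pseudoDivide G'
    ... | k , U' , R' , eq , bR' = suc k , U , R , eq' , bR
      where
      R'' = (a ℤ.^ k * c) ∷ R'
      r = coeff R' d'
      R = scale a R'' ⊕ scale (ℤ.- r) F
      U = scale a (0ℤ ∷ U') ⊕ (r ∷ [])
      bR : DegreeBelow (suc d') R
      bR i le with ℕP.m≤n⇒m<n∨m≡n le
      ... | inj₂ refl = begin
        coeff (scale a R'' ⊕ scale (ℤ.- r) F) (suc d') ≡⟨ coeff-⊕ (scale a R'') (scale (ℤ.- r) F) (suc d') ⟩
        coeff (scale a R'') (suc d') + coeff (scale (ℤ.- r) F) (suc d')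
            ≡⟨ cong₂ _+_ (coeff-scale a R'' (suc d')) (coeff-scale (ℤ.- r) F (suc d')) ⟩
        a * r + ℤ.- r * a ≡⟨ lem a r ⟩
        0ℤ ∎
        where
        lem : ∀ a r → a * r + ℤ.- r * a ≡ 0ℤ
        lem = solve-∀
      ... | inj₁ lt = begin
        coeff (scale a R'' ⊕ scale (ℤ.- r) F) i ≡⟨ coeff-⊕ (scale a R'') (scale (ℤ.- r) F) i ⟩
        coeff (scale a R'') i + coeff (scale (ℤ.- r) F) i
            ≡⟨ cong₂ _+_ (DegreeBelow-scale a R'' (DegreeBelow-∷ bR') i lt) (DegreeBelow-scale (ℤ.- r) F (proj₂ hF) i lt) ⟩
        0ℤ ∎
      eq1 : scale (a ℤ.^ k) (c ∷ G') ≋ F ⊛ (0ℤ ∷ U') ⊕ R''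
      eq1 = ≋-trans (∷-cong refl eq) (≋-trans (∷-cong (sym (ℤP.+-identityˡ (a ℤ.^ k * c))) (≋-refl {F ⊛ U' ⊕ R'}))
             (⊕-cong (≋-sym (⊛-X F U')) (≋-refl {R''})))
      eqr : scale a R'' ≋ R ⊕ F ⊛ (r ∷ [])
      eqr = mk≋ λ i → begin
        coeff (scale a R'') i ≡⟨ lem (coeff (scale a R'') i) (coeff F i) r ⟩
        coeff (scale a R'') i + ℤ.- r * coeff F i + r * coeff F i
            ≡⟨ cong₂ _+_ (sym (trans (coeff-⊕ (scale a R'') (scale (ℤ.- r) F) i)
            (cong+ˡ (coeff (scale a R'') i) (coeff-scale (ℤ.- r) F i)))) (sym (coeff-scale r F i)) ⟩
        coeff R i + coeff (scale r F) i ≡⟨ sym (coeff-⊕ R (scale r F) i) ⟩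
        coeff (R ⊕ scale r F) i
            ≡⟨ at (⊕-cong (≋-refl {R}) (≋-sym (≋-trans (⊛-∷ʳ F r [])
            (≋-trans (⊕-cong (≋-refl {scale r F}) (∷-cong refl (⊛-zeroʳ F))) (⊕-zero∷ (scale r F)))))) i ⟩
        coeff (R ⊕ F ⊛ (r ∷ [])) i ∎
        where
        lem : ∀ x y r → x ≡ x + ℤ.- r * y + r * y
        lem = solve-∀
      eq' : scale (a ℤ.^ suc k) (c ∷ G') ≋ F ⊛ U ⊕ R
      eq' = ≋-trans (≋-sym (scale-scale a (a ℤ.^ k) (c ∷ G')))
            (≋-trans (scale-cong {a} refl eq1)
            (≋-trans (scale-⊕ a (F ⊛ (0ℤ ∷ U')) R'')
            (≋-trans (⊕-cong (≋-sym (⊛-scaleʳ F a (0ℤ ∷ U'))) eqr)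
            (≋-trans (≋-sym (⊕-assoc (F ⊛ scale a (0ℤ ∷ U')) R (F ⊛ (r ∷ []))))
            (≋-trans (⊕-cong (⊕-comm (F ⊛ scale a (0ℤ ∷ U')) R) (≋-refl {F ⊛ (r ∷ [])}))
            (≋-trans (⊕-assoc R (F ⊛ scale a (0ℤ ∷ U')) (F ⊛ (r ∷ [])))
            (≋-trans (⊕-cong (≋-refl {R}) (≋-sym (⊛-⊕ʳ F (scale a (0ℤ ∷ U')) (r ∷ []))))
            (⊕-comm R (F ⊛ U)))))))))

module ReductionModPrime (p : ℕ.ℕ) (pp : Prime p) where

  open IntegerPolynomial
  open import Data.Nat as ℕ using (ℕ; zero; suc; _≤_; _<_; z≤n; s≤s)
  import Data.Nat.Properties as ℕP
  import Data.Nat.Divisibility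
  open import Data.Nat.Primality using (euclidsLemma; prime⇒nonZero; prime⇒nonTrivial)
  open import Data.Integer as ℤ using (ℤ; +_; ∣_∣; _+_; _*_; -_; 0ℤ; 1ℤ)
  import Data.Integer.Properties as ℤP
  open import Data.Integer.Tactic.RingSolver using (solve-∀)
  open import Data.Integer.Divisibility.Signed using (_∣_; _∣?_; divides; ∣⇒∣ᵤ; ∣ᵤ⇒∣; ∣m∣n⇒∣m+n; ∣m+n∣m⇒∣n; ∣m⇒∣m*n; ∣n⇒∣m*n; ∣-refl)
  open import Data.List using (List; []; _∷_)
  open import Data.Product using (Σ; _×_; _,_; proj₁; proj₂)
  open import Data.Sum using (_⊎_; inj₁; inj₂)
  open import Data.Empty using (⊥; ⊥-elim)
  open import Induction.WellFounded using (Acc; acc)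
  import Relation.Binary.Construct.On as On
  import Data.Nat.Induction as ℕI
  open import Relation.Nullary using (¬_; yes; no)
  open import Relation.Binary.Definitions using (tri<; tri≈; tri>)
  open import Relation.Binary.PropositionalEquality using (_≡_; refl; cong; cong₂; sym; trans; subst)
  open import Relation.Binary.PropositionalEquality.Properties using (module ≡-Reasoning)
  open ≡-Reasoning

  P : ℤ
  P = + p

  instance
    p-nonZero : ℕ.NonZero p
    p-nonZero = prime⇒nonZero pp

  P∣0 : P ∣ 0ℤ
  P∣0 = divides 0ℤ refl

  euclid : ∀ a b → ¬ P ∣ a → ¬ P ∣ b → ¬ P ∣ (a * b)
  euclid a b na nb d with euclidsLemma ∣ a ∣ ∣ b ∣ pp (subst (p Data.Nat.Divisibility.∣_) (ℤP.abs-* a b) (∣⇒∣ᵤ d))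
  ... | inj₁ x = na (∣ᵤ⇒∣ x)
  ... | inj₂ y = nb (∣ᵤ⇒∣ y)

  Divisible : Poly → Set
  Divisible f = ∀ i → P ∣ coeff f i

  LowestModP : ℕ → Poly → Set
  LowestModP k f = (∀ i → i < k → P ∣ coeff f i) × (¬ P ∣ coeff f k)

  lowestModP? : ∀ f → Divisible f ⊎ Σ ℕ (λ k → LowestModP k f)
  lowestModP? [] = inj₁ (λ i → P∣0)
  lowestModP? (a ∷ f) with P ∣? a
  ... | no na = inj₂ (0 , (λ i ()) , na)
  ... | yes pa with lowestModP? f
  ...   | inj₁ d = inj₁ λ { zero → pa ; (suc i) → d i }
  ...   | inj₂ (k , lo , nk) = inj₂ (suc k , (λ { zero _ → pa ; (suc i) (s≤s lt) → lo i lt }) , nk)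

  LowestModP-unique : ∀ {k k' f} → LowestModP k f → LowestModP k' f → k ≡ k'
  LowestModP-unique {k} {k'} (lo , nk) (lo' , nk') with ℕP.<-cmp k k'
  ... | tri< lt _ _ = ⊥-elim (nk (lo' k lt))
  ... | tri≈ _ e _ = e
  ... | tri> _ _ gt = ⊥-elim (nk' (lo k' gt))

  Divisible-≋ : ∀ {f g} → f ≋ g → Divisible f → Divisible g
  Divisible-≋ e d i = subst (P ∣_) (at e i) (d i)

  LowestModP-≋ : ∀ {k f g} → f ≋ g → LowestModP k f → LowestModP k g
  LowestModP-≋ e (lo , nk) = (λ i lt → subst (P ∣_) (at e i) (lo i lt)) , (λ z → nk (subst (P ∣_) (sym (at e _)) z))

  LowestModP-⊕-divisible : ∀ {k} A B → Divisible A → LowestModP k B → LowestModP k (A ⊕ B)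
  LowestModP-⊕-divisible {k} A B dA (lo , nk) =
    (λ i lt → subst (P ∣_) (sym (coeff-⊕ A B i)) (∣m∣n⇒∣m+n (dA i) (lo i lt))) ,
    (λ z → nk (∣m+n∣m⇒∣n (subst (P ∣_) (coeff-⊕ A B k) z) (dA k)))

  LowestModP-X* : ∀ {k f} → LowestModP k f → LowestModP (suc k) (0ℤ ∷ f)
  LowestModP-X* (lo , nk) = (λ { zero _ → P∣0 ; (suc i) (s≤s lt) → lo i lt }) , nk

  Divisible-scale : ∀ c f → P ∣ c → Divisible (scale c f)
  Divisible-scale c f pc i = subst (P ∣_) (sym (coeff-scale c f i)) (∣m⇒∣m*n (coeff f i) pc)

  LowestModP-⊛-unit : ∀ F → ¬ P ∣ coeff F 0 → ∀ U j → LowestModP j U → LowestModP j (F ⊛ U)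
  LowestModP-⊛-unit F nF [] j (lo , nk) = ⊥-elim (nk P∣0)
  LowestModP-⊛-unit F nF (b ∷ U) zero (lo , nk) = (λ i ()) , (λ z → euclid (coeff F 0) b nF nk (subst (P ∣_) (coeff-⊛-0 F (b ∷ U)) z))
  LowestModP-⊛-unit F nF (b ∷ U) (suc j) (lo , nk) =
    LowestModP-≋ (≋-sym (⊛-∷ʳ F b U)) (LowestModP-⊕-divisible (scale b F) (0ℤ ∷ (F ⊛ U)) (Divisible-scale b F (lo 0 (s≤s z≤n)))
      (LowestModP-X* (LowestModP-⊛-unit F nF U j ((λ i lt → lo (suc i) (s≤s lt)) , nk))))

  LowestModP-⊛ : ∀ F U i j → LowestModP i F → LowestModP j U → LowestModP (i ℕ.+ j) (F ⊛ U)
  LowestModP-⊛ [] U i j (lo , nk) lU = ⊥-elim (nk P∣0)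
  LowestModP-⊛ (a ∷ F) U zero j (lo , nk) lU = LowestModP-⊛-unit (a ∷ F) nk U j lU
  LowestModP-⊛ (a ∷ F) U (suc i) j (lo , nk) lU =
    LowestModP-⊕-divisible (scale a U) (0ℤ ∷ (F ⊛ U)) (Divisible-scale a U (lo 0 (s≤s z≤n)))
      (LowestModP-X* (LowestModP-⊛ F U i j ((λ i' lt → lo (suc i') (s≤s lt)) , nk) lU))

  Divisible⇒scale : ∀ f → Divisible f → Σ Poly λ g → f ≋ scale P g
  Divisible⇒scale [] d = [] , ≋-refl
  Divisible⇒scale (a ∷ f) d with d 0 | Divisible⇒scale f (λ i → d (suc i))
  ... | divides q eq | g , e = (q ∷ g) , ∷-cong (trans eq (ℤP.*-comm q P)) e

  scale-cancel : ∀ f g → scale P f ≋ scale P g → f ≋ g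
  scale-cancel f g e = mk≋ λ i → ℤP.*-cancelˡ-≡ P (coeff f i) (coeff g i)
    (trans (sym (coeff-scale P f i)) (trans (at e i) (coeff-scale P g i)))

  Divisible-⊛ : ∀ F U → Divisible U → Divisible (F ⊛ U)
  Divisible-⊛ F U dU with Divisible⇒scale U dU
  ... | U' , e = Divisible-≋ (≋-sym (≋-trans (⊛-congʳ F e) (⊛-scaleʳ F P U'))) (Divisible-scale P (F ⊛ U') (∣-refl))

  gauss : ∀ F U i → LowestModP i F → Divisible (F ⊛ U) → Divisible U
  gauss F U i lF d with lowestModP? U
  ... | inj₁ dU = dU
  ... | inj₂ (j , lU) = ⊥-elim (proj₂ (LowestModP-⊛ F U i j lF lU) (d (i ℕ.+ j)))

  ∤⇒≢0 : ∀ {a} → ¬ P ∣ a → ¬ a ≡ 0ℤ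
  ∤⇒≢0 na refl = na P∣0

  p>1 : 1 < p
  p>1 = ℕ.nonTrivial⇒n>1 p {{prime⇒nonTrivial pp}}

  Divisible-⊛ˡ : ∀ F U → Divisible F → Divisible (F ⊛ U)
  Divisible-⊛ˡ F U dF with Divisible⇒scale F dF
  ... | F' , e = Divisible-≋ (≋-sym (≋-trans (⊛-congˡ U e) (⊛-scaleˡ P F' U))) (Divisible-scale P (F' ⊛ U) ∣-refl)

  Degree-unscale : ∀ {D G G'} → G ≋ scale P G' → Degree D G → Degree D G'
  Degree-unscale {D} {G} {G'} e (lead≢0 , bz) =
    (λ z → lead≢0 (trans (at e D) (trans (coeff-scale P G' D) (trans (cong (P *_) z) (ℤP.*-zeroʳ P))))) ,
    (λ i le → ℤP.*-cancelˡ-≡ P (coeff G' i) 0ℤ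
                (trans (sym (coeff-scale P G' i)) (trans (sym (at e i)) (trans (bz i le) (sym (ℤP.*-zeroʳ P))))))

  ∣qP∣>∣q∣ : ∀ q → ¬ q * P ≡ 0ℤ → ∣ q ∣ < ∣ q * P ∣
  ∣qP∣>∣q∣ q qP≢0 = subst (∣ q ∣ <_) (sym (ℤP.abs-* q P))
    (ℕP.m<m*n ∣ q ∣ p {{ℕ.≢-nonZero (λ z → qP≢0 (trans (cong (_* P) (ℤP.∣i∣≡0⇒i≡0 {q} z)) (ℤP.*-zeroˡ P)))}} p>1)

  module Eisenstein (p' : ℕ) (Ψ : Poly)
    (Ψ-monic : coeff Ψ p' ≡ 1ℤ) (Ψ-degree : DegreeBelow (suc p') Ψ)
    (Ψ-divisible : ∀ i → i < p' → P ∣ coeff Ψ i) (Ψ-constant : coeff Ψ 0 ≡ P) where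

    coeff-scaleΨ-top : ∀ N → coeff (scale N Ψ) p' ≡ N
    coeff-scaleΨ-top N = trans (coeff-scale N Ψ p') (trans (cong (N *_) Ψ-monic) (ℤP.*-identityʳ N))

    Degree-scaleΨ : ∀ {N} → ¬ N ≡ 0ℤ → Degree p' (scale N Ψ)
    Degree-scaleΨ {N} N≢0 = (λ z → N≢0 (trans (sym (coeff-scaleΨ-top N)) z)) , DegreeBelow-scale N Ψ Ψ-degree

    LowestModP-scaleΨ : ∀ {N} → ¬ P ∣ N → LowestModP p' (scale N Ψ)
    LowestModP-scaleΨ {N} p∤N =
      (λ i lt → subst (P ∣_) (sym (coeff-scale N Ψ i)) (∣n⇒∣m*n N (Ψ-divisible i lt))) ,
      (λ z → p∤N (subst (P ∣_) (coeff-scaleΨ-top N) z))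

    -- Modulo p, N Ψ is N X^p'; so the lowest surviving terms of G and of its cofactor U sit at their
    -- top degrees, both positive, and their constant terms are divisible by p: then p² ∣ N p.
    eisenstein-coprime : ∀ {N G U D i₀} → 0 < D → D < p' → Degree D G → LowestModP i₀ G → ¬ P ∣ N →
                         ¬ scale N Ψ ≋ G ⊛ U
    eisenstein-coprime {N} {G} {U} {D} {i₀} D>0 D<p' hG lG p∤N e = p∤N p∣N
      where
      lowGU : LowestModP p' (G ⊛ U)
      lowGU = LowestModP-≋ e (LowestModP-scaleΨ p∤N)
      degGU : Degree p' (G ⊛ U)
      degGU = Degree-≋ e (Degree-scaleΨ (∤⇒≢0 p∤N))
      lowU : Σ ℕ λ j → LowestModP j U
      lowU with lowestModP? U
      ... | inj₁ dU = ⊥-elim (proj₂ lowGU (Divisible-⊛ G U dU p'))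
      ... | inj₂ r = r
      degU : Σ ℕ λ j → Degree j U
      degU with degree? U
      ... | inj₁ z = ⊥-elim (proj₁ degGU (at (≋-trans (⊛-congʳ G z) (⊛-zeroʳ G)) p'))
      ... | inj₂ r = r
      j₀ = proj₁ lowU
      j₁ = proj₁ degU
      D+j₁≡p' : D ℕ.+ j₁ ≡ p'
      D+j₁≡p' = Degree-unique {f = G ⊛ U} (Degree-⊛ G U D j₁ hG (proj₂ degU)) degGU
      i₀+j₀≡p' : i₀ ℕ.+ j₀ ≡ p'
      i₀+j₀≡p' = LowestModP-unique {f = G ⊛ U} (LowestModP-⊛ G U i₀ j₀ lG (proj₂ lowU)) lowGU
      i₀≤D : i₀ ℕ.≤ D
      i₀≤D = index≤degree {f = G} (proj₂ hG) (∤⇒≢0 (proj₂ lG))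
      j₀≤j₁ : j₀ ℕ.≤ j₁
      j₀≤j₁ = index≤degree {f = U} (proj₂ (proj₂ degU)) (∤⇒≢0 (proj₂ (proj₂ lowU)))
      i₀≡D : i₀ ≡ D
      i₀≡D with ℕP.m≤n⇒m<n∨m≡n i₀≤D
      ... | inj₂ eq = eq
      ... | inj₁ lt = ⊥-elim (ℕP.<-irrefl (trans i₀+j₀≡p' (sym D+j₁≡p')) (ℕP.+-mono-<-≤ lt j₀≤j₁))
      j₀≡j₁ : j₀ ≡ j₁
      j₀≡j₁ = ℕP.+-cancelˡ-≡ D j₀ j₁ (trans (cong (ℕ._+ j₀) (sym i₀≡D)) (trans i₀+j₀≡p' (sym D+j₁≡p')))
      j₁>0 : 0 < j₁
      j₁>0 with j₁ | D+j₁≡p'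
      ... | zero | eq = ⊥-elim (ℕP.<-irrefl (trans (sym (ℕP.+-identityʳ D)) eq) D<p')
      ... | suc _ | _ = s≤s z≤n
      p∣N : P ∣ N
      p∣N with proj₁ lG 0 (subst (0 <_) (sym i₀≡D) D>0) | proj₁ (proj₂ lowU) 0 (subst (0 <_) (sym j₀≡j₁) j₁>0)
      ... | divides x ex | divides y ey = divides (x * y) (ℤP.*-cancelʳ-≡ N (x * y * P) P (begin
        N * P                 ≡⟨ cong (N *_) (sym Ψ-constant) ⟩
        N * coeff Ψ 0         ≡⟨ sym (coeff-scale N Ψ 0) ⟩
        coeff (scale N Ψ) 0   ≡⟨ at e 0 ⟩
        coeff (G ⊛ U) 0       ≡⟨ coeff-⊛-0 G U ⟩
        coeff G 0 * coeff U 0 ≡⟨ cong₂ _*_ ex ey ⟩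
        (x * P) * (y * P)     ≡⟨ rearrange x y P ⟩
        x * y * P * P         ∎))
        where
        rearrange : ∀ x y z → (x * z) * (y * z) ≡ x * y * z * z
        rearrange = solve-∀

    cancel-cofactor : ∀ {q G U i₀} → LowestModP i₀ G → scale (q * P) Ψ ≋ G ⊛ U → Σ Poly λ U' → scale q Ψ ≋ G ⊛ U'
    cancel-cofactor {q} {G} {U} lG e with Divisible⇒scale U (gauss G U _ lG (Divisible-≋ e (Divisible-scale (q * P) Ψ (∣n⇒∣m*n q ∣-refl))))
    ... | U' , U≋ = U' , scale-cancel (scale q Ψ) (G ⊛ U')
          (≋-trans (scale-scale P q Ψ) (≋-trans (scale-cong (ℤP.*-comm P q) ≋-refl)
          (≋-trans e (≋-trans (⊛-congʳ G U≋) (⊛-scaleʳ G P U')))))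

    cancel-factor : ∀ {q G G' U} → G ≋ scale P G' → scale (q * P) Ψ ≋ G ⊛ U → scale q Ψ ≋ G' ⊛ U
    cancel-factor {q} {G} {G'} {U} G≋ e = scale-cancel (scale q Ψ) (G' ⊛ U)
      (≋-trans (scale-scale P q Ψ) (≋-trans (scale-cong (ℤP.*-comm P q) ≋-refl)
      (≋-trans e (≋-trans (⊛-congˡ U G≋) (⊛-scaleˡ P G' U)))))

    p∣N : ∀ {N G U} → Divisible G → scale N Ψ ≋ G ⊛ U → P ∣ N
    p∣N {N} {G} {U} dG e = subst (P ∣_) (trans (sym (at e p')) (coeff-scaleΨ-top N)) (Divisible-⊛ˡ G U dG p')

    -- Strong induction on ∣ N ∣: whenever p ∣ N, a factor p can be cancelled from G or from U.
    eisenstein : ∀ {N G U D} → ¬ N ≡ 0ℤ → 0 < D → D < p' → Degree D G → ¬ scale N Ψ ≋ G ⊛ U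
    eisenstein {N} {G} {U} = go N (On.wellFounded ∣_∣ ℕI.<-wellFounded N) {G} {U}
      where
      go : ∀ N → Acc (λ M N → ∣ M ∣ < ∣ N ∣) N →
           ∀ {G U D} → ¬ N ≡ 0ℤ → 0 < D → D < p' → Degree D G → ¬ scale N Ψ ≋ G ⊛ U
      go N (acc smaller) {G} {U} N≢0 D>0 D<p' hG e with lowestModP? G | P ∣? N
      ... | inj₂ (_ , lG) | no p∤N = eisenstein-coprime {N} {G} {U} D>0 D<p' hG lG p∤N e
      ... | inj₂ (_ , lG) | yes (divides q refl) with cancel-cofactor {q} {G} {U} lG e
      ...   | U' , e' = go q (smaller {q} (∣qP∣>∣q∣ q N≢0)) {G} {U'} (λ { refl → N≢0 refl }) D>0 D<p' hG e'
      go N (acc smaller) {G} {U} N≢0 D>0 D<p' hG e | inj₁ dG | _ with Divisible⇒scale G dG | p∣N {N} {G} {U} dG e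
      ... | G' , G≋ | divides q refl =
        go q (smaller {q} (∣qP∣>∣q∣ q N≢0)) {G'} {U} (λ { refl → N≢0 refl }) D>0 D<p'
          (Degree-unscale {G = G} G≋ hG) (cancel-factor {q} {G} {G'} {U} G≋ e)

module Binomial where

  open import Data.Nat using (ℕ; zero; suc; _+_; _*_; _<_; s≤s; z≤n)
  open import Data.Nat.Properties using (<⇒≱; *-zeroʳ; *-identityˡ; *-identityʳ)
  open import Data.Nat.Combinatorics using (_C_; nCk+nC[k+1]≡[n+1]C[k+1]; k>n⇒nCk≡0; nC1≡n)
  open import Data.Nat.Divisibility using (_∣_; m∣m*n; ∣⇒≤)
  open import Data.Nat.Primality using (Prime; euclidsLemma)
  open import Data.Nat.Tactic.RingSolver using (solve-∀)
  open import Data.Sum using (inj₁; inj₂)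
  open import Data.Empty using (⊥-elim)
  open import Relation.Binary.PropositionalEquality using (_≡_; refl; cong; cong₂; sym; trans; subst)
  open import Relation.Binary.PropositionalEquality.Properties using (module ≡-Reasoning)
  open ≡-Reasoning

  [1+k]*[1+n]C[1+k] : ∀ n k → suc k * (suc n C suc k) ≡ suc n * (n C k)
  [1+k]*[1+n]C[1+k] zero zero = refl
  [1+k]*[1+n]C[1+k] zero (suc k) = trans (cong (suc (suc k) *_) (k>n⇒nCk≡0 {1} {suc (suc k)} (s≤s (s≤s z≤n)))) (*-zeroʳ (suc (suc k)))
  [1+k]*[1+n]C[1+k] (suc n) zero = trans (*-identityˡ _) (trans (nC1≡n (suc (suc n))) (sym (*-identityʳ _)))
  [1+k]*[1+n]C[1+k] (suc n) (suc k) = begin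
    suc (suc k) * (suc (suc n) C suc (suc k))
      ≡⟨ cong (suc (suc k) *_) (sym (nCk+nC[k+1]≡[n+1]C[k+1] (suc n) (suc k))) ⟩
    suc (suc k) * (a + b)
      ≡⟨ split (suc k) a b ⟩
    (suc k * a + a) + suc (suc k) * b
      ≡⟨ cong₂ (λ x y → (x + a) + y) ([1+k]*[1+n]C[1+k] n k) ([1+k]*[1+n]C[1+k] n (suc k)) ⟩
    (suc n * (n C k) + a) + suc n * (n C suc k)
      ≡⟨ merge (suc n) (n C k) (n C suc k) a ⟩
    suc n * (n C k + n C suc k) + a
      ≡⟨ cong (λ z → suc n * z + a) (nCk+nC[k+1]≡[n+1]C[k+1] n k) ⟩
    suc n * a + a
      ≡⟨ absorb (suc n) a ⟩
    suc (suc n) * a ∎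
    where
    a = suc n C suc k
    b = suc n C suc (suc k)
    split : ∀ k x y → suc k * (x + y) ≡ (k * x + x) + suc k * y
    split = solve-∀
    merge : ∀ m x y z → (m * x + z) + m * y ≡ m * (x + y) + z
    merge = solve-∀
    absorb : ∀ m x → m * x + x ≡ suc m * x
    absorb = solve-∀

  prime∣pCk : ∀ {p} → Prime p → ∀ {k} → 0 < k → k < p → p ∣ p C k
  prime∣pCk {suc n} pp {suc k} _ k<p
    with euclidsLemma (suc k) (suc n C suc k) pp
           (subst (suc n ∣_) (sym ([1+k]*[1+n]C[1+k] n k)) (m∣m*n (n C k)))
  ... | inj₂ p∣C = p∣C
  ... | inj₁ p∣k = ⊥-elim (<⇒≱ k<p (∣⇒≤ p∣k))

module SpecialPolynomials where

  open IntegerPolynomial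
  open Preliminaries using (altSign)
  open import Data.Nat as ℕ using (ℕ; zero; suc; _≤_; _<_; z≤n; s≤s)
  import Data.Nat.Properties as ℕP
  open import Data.Nat.Combinatorics using (_C_; nCk+nC[k+1]≡[n+1]C[k+1])
  open import Data.Nat.Divisibility using (divides) renaming (_∣_ to _∣ℕ_)
  open import Data.Integer as ℤ using (ℤ; +_; _+_; _*_; -_; 0ℤ; 1ℤ)
  import Data.Integer.Properties as ℤP
  open import Data.Integer.Tactic.RingSolver using (solve-∀)
  open import Data.List using (List; []; _∷_; length)
  open import Data.Product using (_×_; _,_)
  open import Data.Sum using (_⊎_; inj₁; inj₂)
  open import Data.Empty using (⊥-elim)
  open import Relation.Nullary using (¬_)
  open import Relation.Binary.PropositionalEquality using (_≡_; refl; cong; cong₂; sym; trans; subst)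

  1+X : Poly
  1+X = 1ℤ ∷ 1ℤ ∷ []

  ⊛-oneˡ : ∀ g → (1ℤ ∷ []) ⊛ g ≋ g
  ⊛-oneˡ g = ≋-trans (⊕-cong (scale-1 g) (≋-refl {0ℤ ∷ []})) (⊕-zero∷ g)

  1+X-⊛ : ∀ g → 1+X ⊛ g ≋ g ⊕ (0ℤ ∷ g)
  1+X-⊛ g = ⊕-cong (scale-1 g) (∷-cong refl (⊛-oneˡ g))

  coeff-1+X-⊛-zero : ∀ g → coeff (1+X ⊛ g) 0 ≡ coeff g 0
  coeff-1+X-⊛-zero g = trans (at (1+X-⊛ g) 0) (trans (coeff-⊕ g (0ℤ ∷ g) 0) (ℤP.+-identityʳ _))

  coeff-1+X-⊛-suc : ∀ g i → coeff (1+X ⊛ g) (suc i) ≡ coeff g (suc i) + coeff g i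
  coeff-1+X-⊛-suc g i = trans (at (1+X-⊛ g) (suc i)) (coeff-⊕ g (0ℤ ∷ g) (suc i))

  [1+X]^ : ℕ → Poly
  [1+X]^ zero = 1ℤ ∷ []
  [1+X]^ (suc k) = 1+X ⊛ [1+X]^ k

  coeff-[1+X]^ : ∀ k i → coeff ([1+X]^ k) i ≡ + (k C i)
  coeff-[1+X]^ zero zero = refl
  coeff-[1+X]^ zero (suc i) = refl
  coeff-[1+X]^ (suc k) zero = trans (coeff-1+X-⊛-zero ([1+X]^ k)) (coeff-[1+X]^ k 0)
  coeff-[1+X]^ (suc k) (suc i) = trans (coeff-1+X-⊛-suc ([1+X]^ k) i)
      (trans (cong₂ _+_ (coeff-[1+X]^ k (suc i)) (coeff-[1+X]^ k i))
      (cong +_ (trans (ℕP.+-comm (k C suc i) (k C i)) (nCk+nC[k+1]≡[n+1]C[k+1] k i))))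

  quotX : Poly → Poly
  quotX [] = []
  quotX (a ∷ f) = f

  coeff-quotX : ∀ f i → coeff (quotX f) i ≡ coeff f (suc i)
  coeff-quotX [] i = refl
  coeff-quotX (a ∷ f) i = refl

  geometric : ℕ → Poly
  geometric zero = []
  geometric (suc n) = 1ℤ ∷ geometric n

  coeff-geometric : ∀ n i → i < n → coeff (geometric n) i ≡ 1ℤ
  coeff-geometric (suc n) zero _ = refl
  coeff-geometric (suc n) (suc i) (s≤s lt) = coeff-geometric n i lt

  compose1+X : Poly → Poly
  compose1+X [] = []
  compose1+X (a ∷ f) = (a ∷ []) ⊕ (1+X ⊛ compose1+X f)

  DegreeBelow-1+X-⊛ : ∀ n g → DegreeBelow n g → DegreeBelow (suc n) (1+X ⊛ g)
  DegreeBelow-1+X-⊛ n g b = DegreeBelow-≋ (≋-sym (1+X-⊛ g))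
      (DegreeBelow-⊕ g (0ℤ ∷ g) (DegreeBelow-mono {f = g} (ℕP.n≤1+n n) b) (DegreeBelow-∷ {a = 0ℤ} b))

  DegreeBelow-0-1+X-⊛ : ∀ g → DegreeBelow 0 g → DegreeBelow 0 (1+X ⊛ g)
  DegreeBelow-0-1+X-⊛ g b = DegreeBelow-≋ (≋-sym (1+X-⊛ g)) (DegreeBelow-⊕ g (0ℤ ∷ g) b (λ { zero _ → refl ; (suc i) _ → b i z≤n }))

  DegreeBelow-compose1+X : ∀ n f → DegreeBelow n f → DegreeBelow n (compose1+X f)
  DegreeBelow-compose1+X n [] b = b
  DegreeBelow-compose1+X zero (a ∷ f) b = DegreeBelow-⊕ (a ∷ []) (1+X ⊛ compose1+X f) (λ { zero _ → b 0 z≤n ; (suc i) _ → refl })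
    (DegreeBelow-0-1+X-⊛ (compose1+X f) (DegreeBelow-compose1+X 0 f (λ i _ → b (suc i) z≤n)))
  DegreeBelow-compose1+X (suc n) (a ∷ f) b = DegreeBelow-⊕ (a ∷ []) (1+X ⊛ compose1+X f) (λ { zero () ; (suc i) _ → refl })
    (DegreeBelow-1+X-⊛ n (compose1+X f) (DegreeBelow-compose1+X n f (DegreeBelow-tail {a = a} b)))

  alternating⇒zero : ∀ S → (∀ k → coeff S k + coeff S (suc k) ≡ 0ℤ) → S ≋ []
  alternating⇒zero S h = mk≋ λ i → go i (length S) (ℕP.m≤n+m (length S) i)
    where
    go : ∀ i m → length S ≤ i ℕ.+ m → coeff S i ≡ 0ℤ
    go i zero le = DegreeBelow-len S i (subst (length S ≤_) (ℕP.+-identityʳ i) le)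
    go i (suc m) le = trans (sym (ℤP.+-identityʳ _))
        (trans (cong+ˡ (coeff S i) (sym (go (suc i) m (subst (length S ≤_) (ℕP.+-suc i m) le)))) (h i))

  compose1+X-zero : ∀ f → compose1+X f ≋ [] → f ≋ []
  compose1+X-zero [] e = e
  compose1+X-zero (a ∷ f) e = mk≋ λ { zero → a≡0 ; (suc i) → at (compose1+X-zero f S0) i }
    where
    S = compose1+X f
    c0 : a + coeff S 0 ≡ 0ℤ
    c0 = trans (sym (trans (coeff-⊕ (a ∷ []) (1+X ⊛ S) 0) (cong+ˡ a (coeff-1+X-⊛-zero S)))) (at e 0)
    cs : ∀ k → coeff S k + coeff S (suc k) ≡ 0ℤ
    cs k = trans (ℤP.+-comm (coeff S k) (coeff S (suc k)))
       (trans (sym (trans (coeff-⊕ (a ∷ []) (1+X ⊛ S) (suc k)) (trans (ℤP.+-identityˡ _) (coeff-1+X-⊛-suc S k)))) (at e (suc k)))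
    S0 : S ≋ []
    S0 = alternating⇒zero S cs
    a≡0 : a ≡ 0ℤ
    a≡0 = trans (sym (ℤP.+-identityʳ a)) (trans (cong+ˡ a (sym (at S0 0))) c0)

  alternate : Poly → Poly
  alternate [] = []
  alternate (a ∷ f) = a ∷ scale (- 1ℤ) (alternate f)

  coeff-alternate : ∀ f k → coeff (alternate f) k ≡ altSign k * coeff f k
  coeff-alternate [] k = sym (ℤP.*-zeroʳ (altSign k))
  coeff-alternate (a ∷ f) zero = sym (ℤP.*-identityˡ a)
  coeff-alternate (a ∷ f) (suc k) = trans (coeff-scale (- 1ℤ) (alternate f) k)
      (trans (cong (- 1ℤ *_) (coeff-alternate f k)) (lem (altSign k) (coeff f k)))
    where
    lem : ∀ s x → - 1ℤ * (s * x) ≡ - s * x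
    lem = solve-∀

  DegreeBelow-alternate : ∀ n f → DegreeBelow n f → DegreeBelow n (alternate f)
  DegreeBelow-alternate n f b i le = trans (coeff-alternate f i) (trans (cong (altSign i *_) (b i le)) (ℤP.*-zeroʳ (altSign i)))

  DegreeBelow-geometric : ∀ n → DegreeBelow n (geometric n)
  DegreeBelow-geometric zero i _ = refl
  DegreeBelow-geometric (suc n) = DegreeBelow-∷ (DegreeBelow-geometric n)

module Evaluation {c ℓ : Level} (F : CharZeroField c ℓ) where

  open IntegerPolynomial
  open SpecialPolynomials
  open Preliminaries using (altSign)
  open import Data.Nat as ℕ using (ℕ; zero; suc)
  import Data.Nat.Properties as ℕP
  open import Data.Integer as ℤ using (ℤ; +_; -[1+_]; ∣_∣; sign; _◃_)
  import Data.Integer.Properties as ℤP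
  open import Data.Sign as Sign using (Sign)
  open import Data.List using (List; []; _∷_; _++_; length)
  open import Data.Maybe using (Maybe; just; nothing)
  open import Data.Product using (_,_)
  open import Data.Empty using (⊥-elim)
  open import Relation.Nullary using (¬_; yes; no)
  open import Relation.Binary.PropositionalEquality as Eq using (_≡_; cong)
  import Algebra.Bundles
  open import Algebra.Solver.Ring.AlmostCommutativeRing using (AlmostCommutativeRing; fromCommutativeRing; _-Raw-AlmostCommutative⟶_)
  import Algebra.Solver.Ring

  open CharZeroField F
  open import Relation.Binary.Reasoning.Setoid setoid
  open import Algebra.Properties.Ring ring using (-1*x≈-x; -‿involutive; -0#≈0#) renaming (-‿+-comm to neg-+)
  open import Algebra.Properties.CommutativeSemigroup *-commutativeSemigroup using (interchange)

  ιℕ : ℕ → Carrier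
  ιℕ = natToCarrier

  ιℕ-+ : ∀ m n → ιℕ (m ℕ.+ n) ≈ ιℕ m + ιℕ n
  ιℕ-+ zero n = sym (+-identityˡ _)
  ιℕ-+ (suc m) n = trans (+-congˡ (ιℕ-+ m n)) (sym (+-assoc _ _ _))

  ιℕ-* : ∀ m n → ιℕ (m ℕ.* n) ≈ ιℕ m * ιℕ n
  ιℕ-* zero n = sym (zeroˡ _)
  ιℕ-* (suc m) n = begin
    ιℕ (n ℕ.+ m ℕ.* n) ≈⟨ ιℕ-+ n (m ℕ.* n) ⟩
    ιℕ n + ιℕ (m ℕ.* n) ≈⟨ +-congˡ (ιℕ-* m n) ⟩
    ιℕ n + ιℕ m * ιℕ n ≈⟨ +-congʳ (sym (*-identityˡ _)) ⟩
    1# * ιℕ n + ιℕ m * ιℕ n ≈⟨ sym (distribʳ _ _ _) ⟩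
    (1# + ιℕ m) * ιℕ n ∎

  ι : ℤ → Carrier
  ι (+ n) = ιℕ n
  ι -[1+ n ] = - ιℕ (suc n)

  ι-⊖ : ∀ m n → ι (m ℤ.⊖ n) ≈ ιℕ m - ιℕ n
  ι-⊖ zero zero = sym (trans (+-congˡ -0#≈0#) (+-identityʳ _))
  ι-⊖ (suc m) zero = sym (trans (+-congˡ -0#≈0#) (+-identityʳ _))
  ι-⊖ zero (suc n) = sym (+-identityˡ _)
  ι-⊖ (suc m) (suc n) = begin
    ι (suc m ℤ.⊖ suc n) ≡⟨ cong ι (ℤP.[1+m]⊖[1+n]≡m⊖n m n) ⟩
    ι (m ℤ.⊖ n) ≈⟨ ι-⊖ m n ⟩
    ιℕ m - ιℕ n ≈⟨ lem ⟩
    (1# + ιℕ m) - (1# + ιℕ n) ∎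
    where
    lem : ιℕ m - ιℕ n ≈ (1# + ιℕ m) - (1# + ιℕ n)
    lem = begin
      ιℕ m - ιℕ n ≈⟨ sym (+-identityˡ _) ⟩
      0# + (ιℕ m - ιℕ n) ≈⟨ +-congʳ (sym (-‿inverseʳ 1#)) ⟩
      (1# - 1#) + (ιℕ m - ιℕ n) ≈⟨ +-assoc _ _ _ ⟩
      1# + (- 1# + (ιℕ m - ιℕ n)) ≈⟨ +-congˡ (trans (sym (+-assoc _ _ _)) (trans (+-congʳ (+-comm _ _)) (+-assoc _ _ _))) ⟩
      1# + (ιℕ m + (- 1# - ιℕ n)) ≈⟨ sym (+-assoc _ _ _) ⟩
      (1# + ιℕ m) + (- 1# - ιℕ n) ≈⟨ +-congˡ (neg-+ 1# (ιℕ n)) ⟩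
      (1# + ιℕ m) - (1# + ιℕ n) ∎

  ι-+ : ∀ a b → ι (a ℤ.+ b) ≈ ι a + ι b
  ι-+ (+ m) (+ n) = ιℕ-+ m n
  ι-+ (+ m) -[1+ n ] = ι-⊖ m (suc n)
  ι-+ -[1+ m ] (+ n) = trans (ι-⊖ n (suc m)) (+-comm _ _)
  ι-+ -[1+ m ] -[1+ n ] = begin
    - ιℕ (suc (suc (m ℕ.+ n))) ≡⟨ cong (λ k → - ιℕ (suc k)) (Eq.sym (ℕP.+-suc m n)) ⟩
    - ιℕ (suc m ℕ.+ suc n) ≈⟨ -‿cong (ιℕ-+ (suc m) (suc n)) ⟩
    - (ιℕ (suc m) + ιℕ (suc n)) ≈⟨ sym (neg-+ _ _) ⟩
    - ιℕ (suc m) + - ιℕ (suc n) ∎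

  ιSign : Sign → Carrier
  ιSign Sign.+ = 1#
  ιSign Sign.- = - 1#

  ι-◃ : ∀ s n → ι (s ◃ n) ≈ ιSign s * ιℕ n
  ι-◃ s zero = sym (zeroʳ _)
  ι-◃ Sign.+ (suc n) = sym (*-identityˡ _)
  ι-◃ Sign.- (suc n) = sym (-1*x≈-x _)

  ι-sign : ∀ a → ι a ≈ ιSign (sign a) * ιℕ ∣ a ∣
  ι-sign (+ n) = sym (*-identityˡ _)
  ι-sign -[1+ n ] = ι-◃ Sign.- (suc n)

  ιSign-* : ∀ s t → ιSign (s Sign.* t) ≈ ιSign s * ιSign t
  ιSign-* Sign.+ Sign.+ = sym (*-identityˡ _)
  ιSign-* Sign.+ Sign.- = sym (*-identityˡ _)
  ιSign-* Sign.- Sign.+ = sym (*-identityʳ _)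
  ιSign-* Sign.- Sign.- = sym (trans (-1*x≈-x _) (-‿involutive _))

  ι-* : ∀ a b → ι (a ℤ.* b) ≈ ι a * ι b
  ι-* a b = begin
    ι (a ℤ.* b) ≈⟨ ι-◃ (sign a Sign.* sign b) (∣ a ∣ ℕ.* ∣ b ∣) ⟩
    ιSign (sign a Sign.* sign b) * ιℕ (∣ a ∣ ℕ.* ∣ b ∣) ≈⟨ *-cong (ιSign-* (sign a) (sign b)) (ιℕ-* ∣ a ∣ ∣ b ∣) ⟩
    (ιSign (sign a) * ιSign (sign b)) * (ιℕ ∣ a ∣ * ιℕ ∣ b ∣) ≈⟨ interchange _ _ _ _ ⟩
    (ιSign (sign a) * ιℕ ∣ a ∣) * (ιSign (sign b) * ιℕ ∣ b ∣) ≈⟨ sym (*-cong (ι-sign a) (ι-sign b)) ⟩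
    ι a * ι b ∎

  ι-neg : ∀ a → ι (ℤ.- a) ≈ - ι a
  ι-neg (+ zero) = sym -0#≈0#
  ι-neg (+ suc n) = refl
  ι-neg -[1+ n ] = sym (-‿involutive _)

  ι-0 : ι (+ 0) ≈ 0#
  ι-0 = refl

  ι-1 : ι (+ 1) ≈ 1#
  ι-1 = +-identityʳ _

  almostCommutativeRing : AlmostCommutativeRing c ℓ
  almostCommutativeRing = fromCommutativeRing commRing

  ι-homomorphism : Algebra.Bundles.CommutativeRing.rawRing ℤP.+-*-commutativeRing -Raw-AlmostCommutative⟶ almostCommutativeRing
  ι-homomorphism = record
    { ⟦_⟧ = ι ; +-homo = ι-+ ; *-homo = ι-* ; -‿homo = ι-neg ; 0-homo = ι-0 ; 1-homo = ι-1 }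

  ι-≟ : ∀ a b → Maybe (ι a ≈ ι b)
  ι-≟ a b with a ℤ.≟ b
  ... | yes Eq.refl = just refl
  ... | no _ = nothing

  -- ι is a ring homomorphism, so the ring solver may use integer constants (con).
  module Solver = Algebra.Solver.Ring _ almostCommutativeRing ι-homomorphism ι-≟

  open Solver using (_:+_; _:*_; _:-_; :-_; _:=_; con) renaming (solve to rsolve)

  nonzero-cancel : ∀ {x y} → ¬ x ≈ 0# → x * y ≈ 0# → y ≈ 0#
  nonzero-cancel {x} {y} nx e with inverse x nx
  ... | w , xw = begin
    y ≈⟨ sym (*-identityˡ y) ⟩
    1# * y ≈⟨ *-congʳ (sym xw) ⟩
    (x * w) * y ≈⟨ *-congʳ (*-comm x w) ⟩
    (w * x) * y ≈⟨ *-assoc w x y ⟩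
    w * (x * y) ≈⟨ *-congˡ e ⟩
    w * 0# ≈⟨ zeroʳ w ⟩
    0# ∎

  ι≈0⇒≡0 : ∀ z → ι z ≈ 0# → z ≡ + 0
  ι≈0⇒≡0 (+ zero) _ = Eq.refl
  ι≈0⇒≡0 (+ suc n) e = ⊥-elim (charZero n e)
  ι≈0⇒≡0 -[1+ n ] e = ⊥-elim (charZero n (trans (sym (-‿involutive _)) (trans (-‿cong e) -0#≈0#)))

  ev : Carrier → Poly → Carrier
  ev z [] = 0#
  ev z (a ∷ f) = ι a + z * ev z f

  module _ (z : Carrier) where
    ev-⊕ : ∀ f g → ev z (f ⊕ g) ≈ ev z f + ev z g
    ev-⊕ [] g = sym (+-identityˡ _)
    ev-⊕ (a ∷ f) [] = sym (+-identityʳ _)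
    ev-⊕ (a ∷ f) (b ∷ g) = begin
      ι (a ℤ.+ b) + z * ev z (f ⊕ g) ≈⟨ +-cong (ι-+ a b) (*-congˡ (ev-⊕ f g)) ⟩
      (ι a + ι b) + z * (ev z f + ev z g) ≈⟨ lem (ι a) (ι b) z (ev z f) (ev z g) ⟩
      (ι a + z * ev z f) + (ι b + z * ev z g) ∎
      where
      lem : ∀ A B Z F G → (A + B) + Z * (F + G) ≈ (A + Z * F) + (B + Z * G)
      lem = rsolve 5 (λ A B Z F G → (A :+ B) :+ Z :* (F :+ G) := (A :+ Z :* F) :+ (B :+ Z :* G)) refl

    ev-scale : ∀ c f → ev z (scale c f) ≈ ι c * ev z f
    ev-scale c [] = sym (zeroʳ _)
    ev-scale c (a ∷ f) = begin
      ι (c ℤ.* a) + z * ev z (scale c f) ≈⟨ +-cong (ι-* c a) (*-congˡ (ev-scale c f)) ⟩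
      ι c * ι a + z * (ι c * ev z f) ≈⟨ lem (ι c) (ι a) z (ev z f) ⟩
      ι c * (ι a + z * ev z f) ∎
      where
      lem : ∀ C A Z F → C * A + Z * (C * F) ≈ C * (A + Z * F)
      lem = rsolve 4 (λ C A Z F → C :* A :+ Z :* (C :* F) := C :* (A :+ Z :* F)) refl

    ev-⊛ : ∀ f g → ev z (f ⊛ g) ≈ ev z f * ev z g
    ev-⊛ [] g = sym (zeroˡ _)
    ev-⊛ (a ∷ f) g = begin
      ev z (scale a g ⊕ (+ 0 ∷ (f ⊛ g))) ≈⟨ ev-⊕ (scale a g) (+ 0 ∷ (f ⊛ g)) ⟩
      ev z (scale a g) + (0# + z * ev z (f ⊛ g)) ≈⟨ +-cong (ev-scale a g) (+-congˡ (*-congˡ (ev-⊛ f g))) ⟩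
      ι a * ev z g + (0# + z * (ev z f * ev z g)) ≈⟨ lem (ι a) (ev z g) z (ev z f) ⟩
      (ι a + z * ev z f) * ev z g ∎
      where
      lem : ∀ A G Z F → A * G + (0# + Z * (F * G)) ≈ (A + Z * F) * G
      lem = rsolve 4 (λ A G Z F → A :* G :+ (con (+ 0) :+ Z :* (F :* G)) := (A :+ Z :* F) :* G) refl

    ev-zero : ∀ f → f ≋ [] → ev z f ≈ 0#
    ev-zero [] e = refl
    ev-zero (a ∷ f) e = begin
      ι a + z * ev z f ≈⟨ +-cong (reflexive (Eq.cong ι (_≋_.at e 0))) (*-congˡ (ev-zero f (≋[]-tail e))) ⟩
      0# + z * 0# ≈⟨ +-identityˡ _ ⟩
      z * 0# ≈⟨ zeroʳ z ⟩
      0# ∎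

    ev-≋ : ∀ f g → f ≋ g → ev z f ≈ ev z g
    ev-≋ [] g e = sym (ev-zero g (≋-sym e))
    ev-≋ (a ∷ f) [] e = ev-zero (a ∷ f) e
    ev-≋ (a ∷ f) (b ∷ g) e = +-cong (reflexive (Eq.cong ι (_≋_.at e 0))) (*-congˡ (ev-≋ f g (≋-tail e)))

    ev-constant : ∀ f → DegreeBelow 1 f → ev z f ≈ ι (coeff f 0)
    ev-constant [] _ = refl
    ev-constant (a ∷ f) bz = trans (+-congˡ (trans (*-congˡ (ev-zero f (DegreeBelow-0 (DegreeBelow-tail bz)))) (zeroʳ z))) (+-identityʳ _)

    ev-quotX : ∀ f → ev z f ≈ ι (coeff f 0) + z * ev z (quotX f)
    ev-quotX [] = sym (trans (+-identityˡ _) (zeroʳ z))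
    ev-quotX (a ∷ f) = refl

  pow-+ : ∀ x m n → pow x (m ℕ.+ n) ≈ pow x m * pow x n
  pow-+ x zero n = sym (*-identityˡ _)
  pow-+ x (suc m) n = trans (*-congˡ (pow-+ x m n)) (sym (*-assoc _ _ _))

  ev-alternate : ∀ z f → ev z f ≈ ev (- z) (alternate f)
  ev-alternate z [] = refl
  ev-alternate z (a ∷ f) = begin
    ι a + z * ev z f ≈⟨ +-congˡ (*-congˡ (ev-alternate z f)) ⟩
    ι a + z * ev (- z) (alternate f) ≈⟨ lem (ι a) z (ev (- z) (alternate f)) ⟩
    ι a + (- z) * (ι (ℤ.- (+ 1)) * ev (- z) (alternate f)) ≈⟨ +-congˡ (*-congˡ (sym (ev-scale (- z) (ℤ.- (+ 1)) (alternate f)))) ⟩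
    ι a + (- z) * ev (- z) (scale (ℤ.- (+ 1)) (alternate f)) ∎
    where
    lem : ∀ A Z E → A + Z * E ≈ A + (- Z) * (ι (ℤ.- (+ 1)) * E)
    lem = rsolve 3 (λ A Z E → A :+ Z :* E := A :+ (:- Z) :* (con (ℤ.- (+ 1)) :* E)) refl

  ev-++ : ∀ z f g → ev z (f ++ g) ≈ ev z f + pow z (length f) * ev z g
  ev-++ z [] g = sym (trans (+-identityˡ _) (*-identityˡ _))
  ev-++ z (a ∷ f) g = begin
    ι a + z * ev z (f ++ g) ≈⟨ +-congˡ (*-congˡ (ev-++ z f g)) ⟩
    ι a + z * (ev z f + pow z (length f) * ev z g) ≈⟨ lem (ι a) z (ev z f) (pow z (length f)) (ev z g) ⟩
    (ι a + z * ev z f) + (z * pow z (length f)) * ev z g ∎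
    where
    lem : ∀ A Z F W G → A + Z * (F + W * G) ≈ (A + Z * F) + (Z * W) * G
    lem = rsolve 5 (λ A Z F W G → A :+ Z :* (F :+ W :* G) := (A :+ Z :* F) :+ (Z :* W) :* G) refl

  pow-neg : ∀ x n → pow (- x) n ≈ ι (altSign n) * pow x n
  pow-neg x zero = sym (trans (*-congʳ ι-1) (*-identityˡ _))
  pow-neg x (suc n) = begin
    (- x) * pow (- x) n ≈⟨ *-congˡ (pow-neg x n) ⟩
    (- x) * (ι (altSign n) * pow x n) ≈⟨ lem x (ι (altSign n)) (pow x n) ⟩
    (- ι (altSign n)) * (x * pow x n) ≈⟨ *-congʳ (sym (ι-neg (altSign n))) ⟩
    ι (ℤ.- altSign n) * (x * pow x n) ∎
    where
    lem : ∀ X ιSign W → (- X) * (ιSign * W) ≈ (- ιSign) * (X * W)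
    lem = rsolve 3 (λ X ιSign W → (:- X) :* (ιSign :* W) := (:- ιSign) :* (X :* W)) refl

module PrimitivePthRoot {c ℓ : Level} (F : CharZeroField c ℓ) (p' : ℕ.ℕ) (pp : Prime (ℕ.suc p')) (ξ : CharZeroField.Carrier F)
    (ξ^p≈1 : CharZeroField._≈_ F (CharZeroField.pow F ξ (ℕ.suc p')) (CharZeroField.1# F))
    (ξ≉1 : ¬ CharZeroField._≈_ F ξ (CharZeroField.1# F)) where
  open CharZeroField F
  open IntegerPolynomial
  open SpecialPolynomials
  open Binomial
  open Evaluation F
  open Solver using (_:+_; _:*_; _:-_; :-_; _:=_; con) renaming (solve to rsolve)
  open import Relation.Binary.Reasoning.Setoid setoid
  open import Data.Nat as ℕ using (ℕ; zero; suc; _≤_; _<_; z≤n; s≤s)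
  import Data.Nat.Properties as ℕP
  open import Data.Nat.Combinatorics using (nCn≡1; nC1≡n; k>n⇒nCk≡0)
  open import Data.Integer as ℤ using (ℤ; +_; 0ℤ)
  import Data.Integer.Properties as ℤP
  open import Data.Integer.Divisibility.Signed using (_∣_; ∣ᵤ⇒∣)
  open import Data.List using ([]; _∷_)
  open import Data.Product using (_,_)
  open import Data.Sum using (inj₁; inj₂)
  open import Data.Empty using (⊥-elim)
  open import Relation.Nullary using (yes; no)
  open import Relation.Binary.PropositionalEquality as Eq using (_≡_)
  open import Data.Nat.Combinatorics using (_C_)

  p : ℕ
  p = suc p'

  open ReductionModPrime p pp using (P; p>1; module Eisenstein)

  π : Carrier
  π = ξ - ι (+ 1)

  π≉0 : ¬ π ≈ 0#
  π≉0 e = ξ≉1 (begin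
    ξ ≈⟨ lem ξ ⟩
    (ξ - ι (+ 1)) + ι (+ 1) ≈⟨ +-congʳ e ⟩
    0# + ι (+ 1) ≈⟨ +-identityˡ _ ⟩
    ι (+ 1) ≈⟨ ι-1 ⟩
    1# ∎)
    where
    lem : ∀ x → x ≈ (x - ι (+ 1)) + ι (+ 1)
    lem = rsolve 1 (λ x → x := (x :- con (+ 1)) :+ con (+ 1)) refl

  ev-1+X : ev π 1+X ≈ ξ
  ev-1+X = lem ξ
    where
    lem : ∀ x → ι (+ 1) + (x - ι (+ 1)) * (ι (+ 1) + (x - ι (+ 1)) * 0#) ≈ x
    lem = rsolve 1 (λ x → con (+ 1) :+ (x :- con (+ 1)) :* (con (+ 1) :+ (x :- con (+ 1)) :* con (+ 0)) := x) refl

  ev-[1+X]^ : ∀ k → ev π ([1+X]^ k) ≈ pow ξ k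
  ev-[1+X]^ zero = trans (+-congˡ (zeroʳ π)) (trans (+-identityʳ _) ι-1)
  ev-[1+X]^ (suc k) = trans (ev-⊛ π 1+X ([1+X]^ k)) (*-cong ev-1+X (ev-[1+X]^ k))

  -- Ψ(π) is the p-th cyclotomic polynomial evaluated at ξ = 1 + π, that is ((1 + π)^p - 1) / π.
  Ψ : Poly
  Ψ = quotX ([1+X]^ p)

  coeff-Ψ : ∀ i → coeff Ψ i ≡ + (p C suc i)
  coeff-Ψ i = Eq.trans (coeff-quotX ([1+X]^ p) i) (coeff-[1+X]^ p (suc i))

  ev-Ψ : ev π Ψ ≈ 0#
  ev-Ψ = nonzero-cancel π≉0 (begin
    π * ev π Ψ                                    ≈⟨ lem (π * ev π Ψ) ⟩
    (ι (+ 1) + π * ev π Ψ) - ι (+ 1)              ≈⟨ +-congʳ (+-congʳ (reflexive (Eq.cong ι (Eq.sym (coeff-[1+X]^ p 0))))) ⟩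
    (ι (coeff ([1+X]^ p) 0) + π * ev π Ψ) - ι (+ 1) ≈⟨ +-congʳ (sym (ev-quotX π ([1+X]^ p))) ⟩
    ev π ([1+X]^ p) - ι (+ 1)                      ≈⟨ +-congʳ (trans (trans (ev-[1+X]^ p) ξ^p≈1) (sym ι-1)) ⟩
    ι (+ 1) - ι (+ 1)                              ≈⟨ -‿inverseʳ _ ⟩
    0#                                             ∎)
    where
    lem : ∀ x → x ≈ (ι (+ 1) + x) - ι (+ 1)
    lem = rsolve 1 (λ x → x := (con (+ 1) :+ x) :- con (+ 1)) refl

  Ψ-monic : coeff Ψ p' ≡ + 1
  Ψ-monic = Eq.trans (coeff-Ψ p') (Eq.cong +_ (nCn≡1 p))

  Ψ-degree : DegreeBelow (suc p') Ψ
  Ψ-degree i p≤i = Eq.trans (coeff-Ψ i) (Eq.cong +_ (k>n⇒nCk≡0 (s≤s p≤i)))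

  Ψ-divisible : ∀ i → i < p' → P ∣ coeff Ψ i
  Ψ-divisible i i<p' = Eq.subst (P ∣_) (Eq.sym (coeff-Ψ i)) (∣ᵤ⇒∣ (prime∣pCk pp (s≤s z≤n) (s≤s i<p')))

  Ψ-constant : coeff Ψ 0 ≡ P
  Ψ-constant = Eq.trans (coeff-Ψ 0) (Eq.cong +_ (nC1≡n p))

  open Eisenstein p' Ψ Ψ-monic Ψ-degree Ψ-divisible Ψ-constant using (eisenstein)

  -- A root G of degree d > 0 gives, by pseudo-division, a^k Ψ = G U + R with R(π) = 0 and deg R < d,
  -- hence R = 0 by induction: a factorisation of Ψ excluded by Eisenstein's criterion.
  no-root-of-degree : ∀ d → d < p' → (∀ R → DegreeBelow d R → ev π R ≈ 0# → R ≋ []) →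
                      ∀ G → Degree d G → ¬ ev π G ≈ 0#
  no-root-of-degree zero _ _ G (c≢0 , bz) e = c≢0 (ι≈0⇒≡0 (coeff G 0) (trans (sym (ev-constant π G bz)) e))
  no-root-of-degree (suc d) d<p' smaller-roots G hG@(lead≢0 , _) e with PseudoDivision.pseudoDivide G d hG Ψ
  ... | k , U , R , Ψ-division , R-degree =
    eisenstein {a ℤ.^ k} {G} {U} (λ z → lead≢0 (ℤP.i^n≡0⇒i≡0 a k z)) (s≤s z≤n) d<p' hG
      (≋-trans Ψ-division (≋-trans (⊕-cong (≋-refl {G ⊛ U}) R≋[]) (⊕-identityʳ _)))
    where
    a = coeff G (suc d)
    R≋[] : R ≋ []
    R≋[] = smaller-roots R R-degree (begin
      ev π R                          ≈⟨ sym (+-identityˡ _) ⟩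
      0# + ev π R                     ≈⟨ +-congʳ (sym (trans (*-congʳ e) (zeroˡ _))) ⟩
      ev π G * ev π U + ev π R        ≈⟨ +-congʳ (sym (ev-⊛ π G U)) ⟩
      ev π (G ⊛ U) + ev π R           ≈⟨ sym (ev-⊕ π (G ⊛ U) R) ⟩
      ev π (G ⊛ U ⊕ R)                ≈⟨ sym (ev-≋ π _ _ Ψ-division) ⟩
      ev π (scale (a ℤ.^ k) Ψ)        ≈⟨ ev-scale π (a ℤ.^ k) Ψ ⟩
      ι (a ℤ.^ k) * ev π Ψ            ≈⟨ *-congˡ ev-Ψ ⟩
      ι (a ℤ.^ k) * 0#                ≈⟨ zeroʳ _ ⟩
      0#                              ∎)

  vanishing⇒zero : ∀ n → n ≤ p' → ∀ G → DegreeBelow n G → ev π G ≈ 0# → G ≋ []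
  vanishing⇒zero zero _ G bz _ = DegreeBelow-0 bz
  vanishing⇒zero (suc d) d<p' G bz e with coeff G d ℤ.≟ 0ℤ
  ... | yes lead≡0 = vanishing⇒zero d (ℕP.<⇒≤ d<p') G (DegreeBelow-lower {f = G} bz lead≡0) e
  ... | no lead≢0 = ⊥-elim (no-root-of-degree d d<p' (vanishing⇒zero d (ℕP.<⇒≤ d<p')) G (lead≢0 , bz) e)

  geometric-sum : ∀ n → π * ev ξ (geometric n) ≈ pow ξ n - ι (+ 1)
  geometric-sum zero = trans (zeroʳ π) (sym (trans (+-congʳ (sym ι-1)) (-‿inverseʳ _)))
  geometric-sum (suc n) = begin
    π * (ι (+ 1) + ξ * ev ξ (geometric n)) ≈⟨ l1 ξ (ev ξ (geometric n)) ⟩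
    π + ξ * (π * ev ξ (geometric n)) ≈⟨ +-congˡ (*-congˡ (geometric-sum n)) ⟩
    π + ξ * (pow ξ n - ι (+ 1)) ≈⟨ l2 ξ (pow ξ n) ⟩
    ξ * pow ξ n - ι (+ 1) ∎
    where
    l1 : ∀ x S → (x - ι (+ 1)) * (ι (+ 1) + x * S) ≈ (x - ι (+ 1)) + x * ((x - ι (+ 1)) * S)
    l1 = rsolve 2 (λ x S → (x :- con (+ 1)) :* (con (+ 1) :+ x :* S) := (x :- con (+ 1)) :+ x :* ((x :- con (+ 1)) :* S)) refl
    l2 : ∀ x W → (x - ι (+ 1)) + x * (W - ι (+ 1)) ≈ x * W - ι (+ 1)
    l2 = rsolve 2 (λ x W → (x :- con (+ 1)) :+ x :* (W :- con (+ 1)) := x :* W :- con (+ 1)) refl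

  ev-geometric : ev ξ (geometric p) ≈ 0#
  ev-geometric = nonzero-cancel π≉0 (trans (geometric-sum p) (trans (+-congʳ (trans ξ^p≈1 (sym ι-1))) (-‿inverseʳ _)))

  ev-compose1+X : ∀ f → ev π (compose1+X f) ≈ ev ξ f
  ev-compose1+X [] = refl
  ev-compose1+X (a ∷ f) = begin
    ev π ((a ∷ []) ⊕ (1+X ⊛ compose1+X f)) ≈⟨ ev-⊕ π (a ∷ []) (1+X ⊛ compose1+X f) ⟩
    (ι a + π * 0#) + ev π (1+X ⊛ compose1+X f) ≈⟨ +-cong (trans (+-congˡ (zeroʳ π)) (+-identityʳ _)) (ev-⊛ π 1+X (compose1+X f)) ⟩
    ι a + ev π 1+X * ev π (compose1+X f) ≈⟨ +-congˡ (*-cong ev-1+X (ev-compose1+X f)) ⟩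
    ι a + ξ * ev ξ f ∎

  vanishing⇒constant : ∀ E → DegreeBelow p E → ev ξ E ≈ 0# → ∀ k → k < p → coeff E k ≡ coeff E p'
  vanishing⇒constant E bE e k k<p = ℤP.i-j≡0⇒i≡j (coeff E k) T (Eq.trans (Eq.sym (coeff-E-T k k<p)) (at E-T≋[] k))
    where
    T = coeff E p'
    E-T = E ⊕ scale (ℤ.- T) (geometric p)
    coeff-E-T : ∀ i → i < p → coeff E-T i ≡ coeff E i ℤ.- T
    coeff-E-T i i<p = Eq.trans (coeff-⊕ E _ i) (Eq.cong (λ x → coeff E i ℤ.+ x)
      (Eq.trans (coeff-scale (ℤ.- T) (geometric p) i) (Eq.trans (Eq.cong (ℤ.- T ℤ.*_) (coeff-geometric p i i<p)) (ℤP.*-identityʳ _))))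
    E-T-degree : DegreeBelow p' E-T
    E-T-degree i p'≤i with ℕP.m≤n⇒m<n∨m≡n p'≤i
    ... | inj₁ p≤i = DegreeBelow-⊕ E _ bE (DegreeBelow-scale (ℤ.- T) (geometric p) (DegreeBelow-geometric p)) i p≤i
    ... | inj₂ Eq.refl = Eq.trans (coeff-E-T p' (ℕP.n<1+n p')) (ℤP.+-inverseʳ T)
    ev-E-T : ev ξ E-T ≈ 0#
    ev-E-T = begin
      ev ξ E-T                                   ≈⟨ ev-⊕ ξ E _ ⟩
      ev ξ E + ev ξ (scale (ℤ.- T) (geometric p)) ≈⟨ +-cong e (ev-scale ξ (ℤ.- T) (geometric p)) ⟩
      0# + ι (ℤ.- T) * ev ξ (geometric p)       ≈⟨ +-congˡ (trans (*-congˡ ev-geometric) (zeroʳ _)) ⟩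
      0# + 0#                                    ≈⟨ +-identityʳ _ ⟩
      0#                                         ∎
    E-T≋[] : E-T ≋ []
    E-T≋[] = compose1+X-zero E-T (vanishing⇒zero p' ℕP.≤-refl (compose1+X E-T)
               (DegreeBelow-compose1+X p' E-T E-T-degree) (trans (ev-compose1+X E-T) ev-E-T))

  constant⇒vanishing : ∀ E t → DegreeBelow p E → (∀ k → k < p → coeff E k ≡ t) → ev ξ E ≈ 0#
  constant⇒vanishing E t bE h = begin
    ev ξ E                       ≈⟨ ev-≋ ξ E (scale t (geometric p)) (mk≋ E≋) ⟩
    ev ξ (scale t (geometric p)) ≈⟨ ev-scale ξ t (geometric p) ⟩
    ι t * ev ξ (geometric p)     ≈⟨ *-congˡ ev-geometric ⟩
    ι t * 0#                     ≈⟨ zeroʳ _ ⟩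
    0#                           ∎
    where
    E≋ : ∀ i → coeff E i ≡ coeff (scale t (geometric p)) i
    E≋ i with ℕP.<-≤-connex i p
    ... | inj₁ i<p = Eq.trans (h i i<p) (Eq.sym (Eq.trans (coeff-scale t (geometric p) i)
                       (Eq.trans (Eq.cong (t ℤ.*_) (coeff-geometric p i i<p)) (ℤP.*-identityʳ t))))
    ... | inj₂ p≤i = Eq.trans (bE i p≤i) (Eq.sym (Eq.trans (coeff-scale t (geometric p) i)
                       (Eq.trans (Eq.cong (t ℤ.*_) (DegreeBelow-geometric p i p≤i)) (ℤP.*-zeroʳ t))))

module PrimitiveRoot2p {c ℓ : Level} (F : CharZeroField c ℓ) (ζ : CharZeroField.Carrier F) (p' : ℕ.ℕ) (pp : Prime (ℕ.suc p'))
    (odd : ¬ 2 ∣ℕ ℕ.suc p') (prim : IsPrimitiveRoot F (2 ℕ.* ℕ.suc p') ζ) where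
  open CharZeroField F
  open IntegerPolynomial
  open SpecialPolynomials
  open Preliminaries
  open Evaluation F
  open Solver using (_:+_; _:*_; _:-_; :-_; _:=_; con) renaming (solve to rsolve)
  open import Relation.Binary.Reasoning.Setoid setoid
  open import Algebra.Properties.Ring ring using (-‿involutive)
  open import Data.Nat as ℕ using (ℕ; zero; suc; _<_; z≤n; s≤s)
  import Data.Nat.Properties as ℕP
  open import Data.Nat.Primality using (prime⇒nonTrivial)
  open import Data.Integer as ℤ using (ℤ; +_)
  import Data.Integer.Properties as ℤP
  open import Data.List using (List; []; _∷_; _++_; map; length)
  import Data.List.Properties as DLP
  open import Data.Product using (Σ; _,_; proj₁; proj₂)
  open import Relation.Binary.PropositionalEquality as Eq using (_≡_)

  p : ℕ
  p = suc p'

  ζ^p·ζ^p≈1 : pow ζ p * pow ζ p ≈ 1#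
  ζ^p·ζ^p≈1 = trans (*-congˡ (reflexive (Eq.cong (pow ζ) (Eq.sym (ℕP.+-identityʳ p))))) (trans (sym (pow-+ ζ p (p ℕ.+ 0))) (proj₁ prim))

  ζ^p≈-1 : pow ζ p ≈ ι (ℤ.- + 1)
  ζ^p≈-1 = begin
    w                       ≈⟨ l1 w ⟩
    (w + ι (+ 1)) - ι (+ 1) ≈⟨ +-congʳ w+1≈0 ⟩
    0# - ι (+ 1)            ≈⟨ l2 ⟩
    ι (ℤ.- + 1)             ∎
    where
    w = pow ζ p
    l1 : ∀ W → W ≈ (W + ι (+ 1)) - ι (+ 1)
    l1 = rsolve 1 (λ W → W := (W :+ con (+ 1)) :- con (+ 1)) refl
    l2 : 0# - ι (+ 1) ≈ ι (ℤ.- + 1)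
    l2 = rsolve 0 (con (+ 0) :- con (+ 1) := con (ℤ.- + 1)) refl
    p<2p : p < 2 ℕ.* p
    p<2p = ℕP.m<m+n p {p ℕ.+ 0} (Eq.subst (0 <_) (Eq.sym (ℕP.+-identityʳ p)) (s≤s z≤n))
    w-1≉0 : ¬ (w - ι (+ 1)) ≈ 0#
    w-1≉0 e = proj₂ prim p (s≤s z≤n) p<2p (trans (trans (l1' w) (+-cong e refl)) (trans (+-identityˡ _) ι-1))
      where
      l1' : ∀ W → W ≈ (W - ι (+ 1)) + ι (+ 1)
      l1' = rsolve 1 (λ W → W := (W :- con (+ 1)) :+ con (+ 1)) refl
    w+1≈0 : (w + ι (+ 1)) ≈ 0#
    w+1≈0 = nonzero-cancel w-1≉0 (begin
      (w - ι (+ 1)) * (w + ι (+ 1)) ≈⟨ l3 w ⟩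
      w * w - ι (+ 1)               ≈⟨ +-congʳ ζ^p·ζ^p≈1 ⟩
      1# - ι (+ 1)                  ≈⟨ +-congʳ (sym ι-1) ⟩
      ι (+ 1) - ι (+ 1)             ≈⟨ -‿inverseʳ _ ⟩
      0#                            ∎)
      where
      l3 : ∀ W → (W - ι (+ 1)) * (W + ι (+ 1)) ≈ W * W - ι (+ 1)
      l3 = rsolve 1 (λ W → (W :- con (+ 1)) :* (W :+ con (+ 1)) := W :* W :- con (+ 1)) refl

  -- Since p is odd, ξ = -ζ is a primitive p-th root of unity.
  ξ : Carrier
  ξ = - ζ

  ξ^p≈1 : pow ξ p ≈ 1#
  ξ^p≈1 = begin
    pow ξ p                       ≈⟨ pow-neg ζ p ⟩
    ι (altSign p) * pow ζ p       ≈⟨ *-cong (reflexive (Eq.cong ι (altSign-odd p odd))) ζ^p≈-1 ⟩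
    ι (ℤ.- + 1) * ι (ℤ.- + 1)     ≈⟨ rsolve 0 (con (ℤ.- + 1) :* con (ℤ.- + 1) := con (+ 1)) refl ⟩
    ι (+ 1)                       ≈⟨ ι-1 ⟩
    1#                            ∎

  ξ≉1 : ¬ ξ ≈ 1#
  ξ≉1 e = proj₂ prim 2 (s≤s z≤n) 2<2p ζ²≈1
    where
    p>1 : 1 < p
    p>1 = ℕ.nonTrivial⇒n>1 p {{prime⇒nonTrivial pp}}
    2<2p : 2 < 2 ℕ.* p
    2<2p = ℕP.≤-trans (s≤s (s≤s (s≤s z≤n))) (ℕP.+-mono-≤ p>1 (ℕP.≤-trans p>1 (ℕP.m≤m+n p 0)))
    ζ≈-1 : ζ ≈ - ι (+ 1)
    ζ≈-1 = trans (sym (-‿involutive ζ)) (-‿cong (trans e (sym ι-1)))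
    ζ²≈1 : ζ * (ζ * 1#) ≈ 1#
    ζ²≈1 = trans (*-cong ζ≈-1 (*-cong ζ≈-1 (sym ι-1)))
             (trans (rsolve 0 ((:- con (+ 1)) :* ((:- con (+ 1)) :* con (+ 1)) := con (+ 1)) refl) ι-1)

  open PrimitivePthRoot F p' pp ξ ξ^p≈1 ξ≉1 using (vanishing⇒constant; constant⇒vanishing)

  -- As ζ^p = -1 and ζ = -ξ, Σ u_k ζ^k + Σ v_k ζ^(p+k) = Σ (-1)^k (u_k - v_k) ξ^k.
  twistedDiff : List ℕ → List ℕ → Poly
  twistedDiff u v = alternate (map +_ u ⊕ scale (ℤ.- + 1) (map +_ v))

  coeff-map-+ : ∀ (c : List ℕ) k → coeff (map +_ c) k ≡ + nth c k
  coeff-map-+ [] k = Eq.refl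
  coeff-map-+ (x ∷ c) zero = Eq.refl
  coeff-map-+ (x ∷ c) (suc k) = coeff-map-+ c k

  coeff-twistedDiff : ∀ u v k → coeff (twistedDiff u v) k ≡ altSign k ℤ.* (+ nth u k ℤ.- + nth v k)
  coeff-twistedDiff u v k = Eq.trans (coeff-alternate (map +_ u ⊕ scale (ℤ.- + 1) (map +_ v)) k)
    (Eq.cong (altSign k ℤ.*_) (Eq.trans (coeff-⊕ (map +_ u) (scale (ℤ.- + 1) (map +_ v)) k)
      (Eq.cong₂ ℤ._+_ (coeff-map-+ u k) (Eq.trans (coeff-scale (ℤ.- + 1) (map +_ v) k)
        (Eq.trans (Eq.cong (ℤ.- + 1 ℤ.*_) (coeff-map-+ v k)) (ℤP.-1*i≡-i (+ nth v k)))))))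

  ev-twistedDiff : ∀ u v → length u ≡ p → ev ζ (map +_ (u ++ v)) ≈ ev ξ (twistedDiff u v)
  ev-twistedDiff u v lu = begin
    ev ζ (map +_ (u ++ v))                 ≡⟨ Eq.cong (ev ζ) (DLP.map-++ +_ u v) ⟩
    ev ζ (mu ++ mv)                        ≈⟨ ev-++ ζ mu mv ⟩
    ev ζ mu + pow ζ (length mu) * ev ζ mv  ≈⟨ +-congˡ (*-congʳ (trans (reflexive (Eq.cong (pow ζ) (Eq.trans (DLP.length-map +_ u) lu))) ζ^p≈-1)) ⟩
    ev ζ mu + ι (ℤ.- + 1) * ev ζ mv        ≈⟨ +-congˡ (sym (ev-scale ζ (ℤ.- + 1) mv)) ⟩
    ev ζ mu + ev ζ (scale (ℤ.- + 1) mv)    ≈⟨ sym (ev-⊕ ζ mu (scale (ℤ.- + 1) mv)) ⟩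
    ev ζ (mu ⊕ scale (ℤ.- + 1) mv)         ≈⟨ ev-alternate ζ (mu ⊕ scale (ℤ.- + 1) mv) ⟩
    ev ξ (twistedDiff u v)                 ∎
    where
    mu = map +_ u
    mv = map +_ v

  DegreeBelow-twistedDiff : ∀ u v → length u ≡ p → length v ≡ p → DegreeBelow p (twistedDiff u v)
  DegreeBelow-twistedDiff u v lu lv =
    DegreeBelow-alternate p (mu ⊕ scale (ℤ.- + 1) mv) (DegreeBelow-⊕ mu (scale (ℤ.- + 1) mv) (degree-map u lu)
      (DegreeBelow-scale (ℤ.- + 1) mv (degree-map v lv)))
    where
    mu = map +_ u
    mv = map +_ v
    degree-map : ∀ w → length w ≡ p → DegreeBelow p (map +_ w)
    degree-map w lw = Eq.subst (λ k → DegreeBelow k (map +_ w)) (Eq.trans (DLP.length-map +_ w) lw) (DegreeBelow-len (map +_ w))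

  vanishing⇒alternating : ∀ u v → length u ≡ p → length v ≡ p → ev ζ (map +_ (u ++ v)) ≈ 0# →
                          Σ ℤ (AlternatingDifference p u v)
  vanishing⇒alternating u v lu lv e = T , λ k k<p → Eq.trans (Eq.sym (altSign-involutive k _))
      (Eq.cong (altSign k ℤ.*_) (Eq.trans (Eq.sym (coeff-twistedDiff u v k)) (constant k k<p)))
    where
    T = coeff (twistedDiff u v) p'
    constant = vanishing⇒constant (twistedDiff u v) (DegreeBelow-twistedDiff u v lu lv) (trans (sym (ev-twistedDiff u v lu)) e)

  alternating⇒vanishing : ∀ u v C → length u ≡ p → length v ≡ p → AlternatingDifference p u v C →
                          ev ζ (map +_ (u ++ v)) ≈ 0#
  alternating⇒vanishing u v C lu lv h = trans (ev-twistedDiff u v lu)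
    (constant⇒vanishing (twistedDiff u v) C (DegreeBelow-twistedDiff u v lu lv)
      (λ k k<p → Eq.trans (coeff-twistedDiff u v k) (Eq.trans (Eq.cong (altSign k ℤ.*_) (h k k<p)) (altSign-involutive k C))))

module MultiplicityVector where

  open import Data.Nat as ℕ using (ℕ; zero; suc; _≤_; z≤n; s≤s; _+_)
  import Data.Nat.Properties as ℕP
  open import Data.Fin as Fin using (Fin; zero; suc)
  open import Data.Fin.Properties using (≤-totalOrder)
  import Data.Fin.Properties as FP
  open import Data.List using (List; []; _∷_; _++_; map; length; replicate)
  import Data.List.Properties as DLP
  open import Data.Nat.ListAction using (sum)
  open import Data.Vec as Vec using (Vec; toList)
  open import Data.List.Relation.Unary.Sorted.TotalOrder using (Sorted)
  open import Data.List.Relation.Unary.Linked as Linked using ([]; [-]; _∷_)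
  open import Data.Product using (Σ; _×_; _,_)
  open import Relation.Binary.PropositionalEquality using (_≡_; refl; cong; cong₂; sym; trans)
  open import Relation.Binary.PropositionalEquality.Properties using (module ≡-Reasoning)

  SortedFin : ∀ m → List (Fin m) → Set
  SortedFin m = Sorted (≤-totalOrder m)

  expand : (m : ℕ) → List ℕ → List (Fin m)
  expand zero _ = []
  expand (suc m) [] = []
  expand (suc m) (k ∷ c) = replicate k zero ++ map suc (expand m c)

  map-suc-sorted : ∀ {m} (l : List (Fin m)) → SortedFin m l → SortedFin (suc m) (map suc l)
  map-suc-sorted [] s = []
  map-suc-sorted (x ∷ []) s = [-]
  map-suc-sorted (x ∷ y ∷ l) (r ∷ s) = s≤s r ∷ map-suc-sorted (y ∷ l) s

  zero∷-sorted : ∀ {m} (l : List (Fin (suc m))) → SortedFin (suc m) l → SortedFin (suc m) (zero ∷ l)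
  zero∷-sorted [] s = [-]
  zero∷-sorted (y ∷ l) s = z≤n ∷ s

  replicate-zero-sorted : ∀ {m} k (l : List (Fin (suc m))) → SortedFin (suc m) l → SortedFin (suc m) (replicate k zero ++ l)
  replicate-zero-sorted zero l s = s
  replicate-zero-sorted (suc k) l s = zero∷-sorted (replicate k zero ++ l) (replicate-zero-sorted k l s)

  expand-sorted : ∀ m c → SortedFin m (expand m c)
  expand-sorted zero c = []
  expand-sorted (suc m) [] = []
  expand-sorted (suc m) (k ∷ c) = replicate-zero-sorted k (map suc (expand m c)) (map-suc-sorted (expand m c) (expand-sorted m c))

  unmap-suc : ∀ {m} (y : Fin m) l → SortedFin (suc m) (suc y ∷ l) → Σ (List (Fin m)) λ l' → (suc y ∷ l ≡ map suc (y ∷ l')) × SortedFin m (y ∷ l')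
  unmap-suc y [] s = [] , refl , [-]
  unmap-suc y (zero ∷ l) (() ∷ s)
  unmap-suc y (suc z ∷ l) (s≤s r ∷ s) with unmap-suc z l s
  ... | l' , e , s' = (z ∷ l') , cong (suc y ∷_) e , (r ∷ s')

  split-zeros : ∀ {m} (l : List (Fin (suc m))) → SortedFin (suc m) l →
           Σ ℕ λ k → Σ (List (Fin m)) λ l' → SortedFin m l' × (l ≡ replicate k zero ++ map suc l')
  split-zeros [] s = 0 , [] , [] , refl
  split-zeros (zero ∷ l) s with split-zeros l (Linked.tail s)
  ... | k , l' , s' , e = suc k , l' , s' , cong (zero ∷_) e
  split-zeros (suc y ∷ l) s with unmap-suc y l s
  ... | l' , e , s' = 0 , (y ∷ l') , s' , e

  expand-surjective : ∀ m (l : List (Fin m)) → SortedFin m l → Σ (List ℕ) λ c → (length c ≡ m) × (expand m c ≡ l)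
  expand-surjective zero [] s = [] , refl , refl
  expand-surjective zero (() ∷ l) s
  expand-surjective (suc m) l s with split-zeros l s
  ... | k , l' , s' , e with expand-surjective m l' s'
  ...   | c' , lc , ec = (k ∷ c') , cong suc lc , trans (cong (λ z → replicate k zero ++ map suc z) ec) (sym e)

  replicate-zero-++-injective : ∀ {m} k k' (X X' : List (Fin m)) → replicate k (Fin.zero {m}) ++ map (Fin.suc {m}) X ≡
      replicate k' Fin.zero ++ map Fin.suc X' → (k ≡ k') × (X ≡ X')
  replicate-zero-++-injective {m} zero zero X X' e = refl , DLP.map-injective {f = Fin.suc {m}} FP.suc-injective e
  replicate-zero-++-injective (suc k) (suc k') X X' e with replicate-zero-++-injective k k' X X' (DLP.∷-injectiveʳ e)
  ... | a , b = cong suc a , b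
  replicate-zero-++-injective zero (suc k') [] X' ()
  replicate-zero-++-injective zero (suc k') (x ∷ X) X' ()
  replicate-zero-++-injective (suc k) zero X [] ()
  replicate-zero-++-injective (suc k) zero X (x ∷ X') ()

  expand-injective : ∀ m c c' → length c ≡ m → length c' ≡ m → expand m c ≡ expand m c' → c ≡ c'
  expand-injective zero [] [] _ _ _ = refl
  expand-injective (suc m) (k ∷ c) (k' ∷ c') lc lc' e with replicate-zero-++-injective k k' (expand m c) (expand m c') e
  ... | refl , X = cong (k ∷_) (expand-injective m c c' (ℕP.suc-injective lc) (ℕP.suc-injective lc') X)

  length-expand : ∀ m c → length c ≡ m → length (expand m c) ≡ sum c
  length-expand zero [] _ = refl
  length-expand (suc m) (k ∷ c) lc = begin
    length (replicate k zero ++ map suc (expand m c)) ≡⟨ DLP.length-++ (replicate k zero) ⟩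
    length (replicate k (Fin.zero {m})) + length (map suc (expand m c)) ≡⟨ cong₂ _+_ (DLP.length-replicate k) (DLP.length-map suc (expand m c)) ⟩
    k + length (expand m c) ≡⟨ cong (k +_) (length-expand m c (ℕP.suc-injective lc)) ⟩
    k + sum c ∎
    where open ≡-Reasoning


  FirstZero-expand⇒positive : ∀ m k c → FirstZero (expand (suc m) (k ∷ c)) → 1 ≤ k
  FirstZero-expand⇒positive m (suc k) c _ = s≤s z≤n
  FirstZero-expand⇒positive m zero c fz with expand m c
  FirstZero-expand⇒positive m zero c () | []
  FirstZero-expand⇒positive m zero c () | x ∷ _

  FirstZero-expand : ∀ m k c → 1 ≤ k → FirstZero (expand (suc m) (k ∷ c))
  FirstZero-expand m (suc k) c _ = refl

  toVecOfLength : ∀ {m} (n : ℕ) → List (Fin (suc m)) → Vec (Fin (suc m)) n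
  toVecOfLength zero _ = Vec.[]
  toVecOfLength (suc n) [] = zero Vec.∷ toVecOfLength n []
  toVecOfLength (suc n) (x ∷ l) = x Vec.∷ toVecOfLength n l

  toList-toVecOfLength : ∀ {m} n (l : List (Fin (suc m))) → length l ≡ n → toList (toVecOfLength n l) ≡ l
  toList-toVecOfLength zero [] _ = refl
  toList-toVecOfLength (suc n) (x ∷ l) e = cong (x ∷_) (toList-toVecOfLength n l (ℕP.suc-injective e))

module Cardinality where

  open import Level using (Level; _⊔_)

  open import Data.Nat as ℕ using (ℕ; zero; suc; _+_)
  open import Data.List as List using (List; []; _∷_; _++_; map; length)
  import Data.List.Properties as DLP
  open import Data.Nat.ListAction using (sum)
  open import Data.List.Relation.Unary.Unique.Propositional using (Unique)
  import Data.List.Relation.Unary.Unique.Propositional.Properties as UP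
  open import Data.List.Relation.Unary.AllPairs using ([]; _∷_)
  open import Data.List.Relation.Unary.All as All using (All; []; _∷_)
  open import Data.List.Membership.Propositional using (_∈_; _∉_)
  open import Data.List.Membership.Propositional.Properties as MP using ()
  open import Data.List.Relation.Unary.Any using (here; there)
  open import Data.Product using (Σ; _×_; _,_; proj₁; proj₂)
  open import Data.Sum using (_⊎_; inj₁; inj₂)
  open import Data.Empty using (⊥; ⊥-elim)
  open import Relation.Nullary using (¬_)
  open import Function.Bundles using (_⇔_; mk⇔; Equivalence)
  open import Relation.Binary.PropositionalEquality as Eq using (_≡_; refl; cong; sym; trans; subst)

  private variable
    a b p q : Level

  module _ {A : Set a} where
    HasCard-⇔ : ∀ {P : A → Set p} {Q : A → Set q} {k} → HasCard P k → (∀ x → P x → Q x) → (∀ x → Q x → P x) → HasCard Q k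
    HasCard-⇔ (L , u , m , l) f g = L , u , (λ x → mk⇔ (λ i → f x (Equivalence.to (m x) i)) (λ qx → Equivalence.from (m x) (g x qx))) , l

    HasCard-≡ : ∀ {P : A → Set p} {k k'} → HasCard P k → k ≡ k' → HasCard P k'
    HasCard-≡ h refl = h

    HasCard-∅ : ∀ {P : A → Set p} → (∀ x → ¬ P x) → HasCard P 0
    HasCard-∅ n = [] , [] , (λ x → mk⇔ (λ ()) (λ px → ⊥-elim (n x px))) , refl

    HasCard-1 : ∀ {P : A → Set p} (x₀ : A) → P x₀ → (∀ x → P x → x ≡ x₀) → HasCard P 1
    HasCard-1 x₀ px₀ h = (x₀ ∷ []) , ([] ∷ []) , (λ x → mk⇔ (λ { (here refl) → px₀ }) (λ px → here (h x px))) , refl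

    HasCard-⊎ : ∀ {P : A → Set p} {Q : A → Set q} {k l} → HasCard P k → HasCard Q l → (∀ x → P x → Q x → ⊥) →
           HasCard (λ x → P x ⊎ Q x) (k + l)
    HasCard-⊎ {P = P} {Q} (L , u , m , lk) (L' , u' , m' , ll) dis =
      (L ++ L') , UP.++⁺ u u' (λ { (i , i') → dis _ (Equivalence.to (m _) i) (Equivalence.to (m' _) i') }) ,
      (λ x → mk⇔ (λ i → Data.Sum.map (Equivalence.to (m x)) (Equivalence.to (m' x)) (MP.∈-++⁻ L i))
                 (λ { (inj₁ px) → MP.∈-++⁺ˡ (Equivalence.from (m x) px) ; (inj₂ qx) → MP.∈-++⁺ʳ L (Equivalence.from (m' x) qx) })) ,
      trans (DLP.length-++ L) (Eq.cong₂ _+_ lk ll)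

  module _ {A : Set a} {B : Set b} where
    Unique-map : ∀ (f : A → B) (L : List A) → (∀ x y → x ∈ L → y ∈ L → f x ≡ f y → x ≡ y) → Unique L → Unique (map f L)
    Unique-map f [] inj [] = []
    Unique-map f (x ∷ L) inj (ax ∷ u) = go L ax (λ y yi e → inj x y (here refl) (there yi) e) ∷ Unique-map f L
        (λ y z yi zi → inj y z (there yi) (there zi)) u
      where
      go : ∀ M → All (λ y → ¬ x ≡ y) M → (∀ y → y ∈ M → f x ≡ f y → x ≡ y) → All (λ z → ¬ f x ≡ z) (map f M)
      go [] [] h = []
      go (y ∷ M) (nxy ∷ a) h = (λ e → nxy (h y (here refl) e)) ∷ go M a (λ z zi → h z (there zi))

    HasCard-map : ∀ {P : A → Set p} {Q : B → Set q} {k} (f : A → B) → HasCard P k →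
             (∀ x y → P x → P y → f x ≡ f y → x ≡ y) →
             (∀ x → P x → Q (f x)) →
             (∀ y → Q y → Σ A λ x → P x × f x ≡ y) → HasCard Q k
    HasCard-map {P = P} {Q} f (L , u , m , lk) inj fw bw =
      map f L ,
      Unique-map f L (λ x y xi yi e → inj x y (Equivalence.to (m x) xi) (Equivalence.to (m y) yi) e) u ,
      (λ y → mk⇔ (λ i → image⇒Q y (MP.∈-map⁻ f i)) (λ qy → ∈-image y (bw y qy))) ,
      trans (DLP.length-map f L) lk
      where
      image⇒Q : ∀ y → Σ A (λ x → x ∈ L × y ≡ f x) → Q y
      image⇒Q y (x , xi , refl) = fw x (Equivalence.to (m x) xi)
      ∈-image : ∀ y → Σ A (λ x → P x × f x ≡ y) → y ∈ map f L
      ∈-image y (x , px , refl) = MP.∈-map⁺ f (Equivalence.from (m x) px)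

  module _ {A : Set a} {I : Set b} where
    HasCard-Union : ∀ (Is : List I) (P : I → A → Set p) (k : I → ℕ) → Unique Is →
               (∀ i → i ∈ Is → HasCard (P i) (k i)) →
               (∀ i j x → i ∈ Is → j ∈ Is → P i x → P j x → i ≡ j) →
               HasCard (λ x → Σ I λ i → i ∈ Is × P i x) (sum (map k Is))
    HasCard-Union [] P k u hc dis = HasCard-∅ (λ x → λ { (i , () , _) })
    HasCard-Union (i ∷ Is) P k (ai ∷ u) hc dis =
      HasCard-⇔ (HasCard-⊎ (hc i (here refl)) (HasCard-Union Is P k u (λ j ji → hc j (there ji))
          (λ j j' x ji j'i → dis j j' x (there ji) (there j'i)))
                  (λ x pix → λ { (j , ji , pjx) → All.lookup ai ji (dis i j x (here refl) (there ji) pix pjx) }))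
           (λ x → λ { (inj₁ pix) → i , here refl , pix ; (inj₂ (j , ji , pjx)) → j , there ji , pjx })
           (λ x → λ { (j , here refl , pjx) → inj₁ pjx ; (j , there ji , pjx) → inj₂ (j , ji , pjx) })

module WeakCompositions where

  open Cardinality
  open Preliminaries using (nth)
  open import Data.Nat as ℕ using (ℕ; zero; suc; _≤_; z≤n; s≤s; _+_)
  import Data.Nat.Properties as ℕP
  open import Data.Nat.Combinatorics using (_C_; nCk+nC[k+1]≡[n+1]C[k+1]; nCn≡1)
  open import Data.List using (List; []; _∷_; length; replicate)
  open import Data.List.Properties using (∷-injectiveˡ; ∷-injectiveʳ; length-replicate)
  open import Data.Nat.ListAction using (sum)
  open import Data.Product using (_×_; _,_)
  open import Data.Sum using (_⊎_; inj₁; inj₂)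
  open import Relation.Binary.PropositionalEquality using (_≡_; refl; cong; cong₂; sym; trans)

  WeakComposition : ℕ → ℕ → List ℕ → Set
  WeakComposition m' s b = (length b ≡ suc m') × (sum b ≡ s)

  PositiveHead : List ℕ → Set
  PositiveHead b = 1 ≤ nth b 0

  sum≡0⇒replicate : ∀ b → sum b ≡ 0 → b ≡ replicate (length b) 0
  sum≡0⇒replicate [] e = refl
  sum≡0⇒replicate (zero ∷ b) e = cong (0 ∷_) (sum≡0⇒replicate b e)

  sum-replicate-zero : ∀ k → sum (replicate k 0) ≡ 0
  sum-replicate-zero zero = refl
  sum-replicate-zero (suc k) = sum-replicate-zero k

  private
    incrHead : List ℕ → List ℕ
    incrHead [] = []
    incrHead (x ∷ xs) = suc x ∷ xs

  mutual
    weakComposition-card : ∀ m' s → HasCard (WeakComposition m' s) ((m' + s) C s)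
    weakComposition-card m' zero = HasCard-1 (replicate (suc m') 0) (length-replicate (suc m') , sum-replicate-zero (suc m'))
      (λ b (lb , sb) → trans (sum≡0⇒replicate b sb) (cong (λ k → replicate k 0) lb))
    weakComposition-card zero (suc s) = HasCard-≡ (HasCard-1 (suc s ∷ []) (refl , cong suc (ℕP.+-identityʳ s)) unique)
      (sym (nCn≡1 (suc s)))
      where
      unique : ∀ b → WeakComposition zero (suc s) b → b ≡ suc s ∷ []
      unique (x ∷ []) (refl , e) = cong (_∷ []) (trans (sym (ℕP.+-identityʳ x)) e)
    weakComposition-card (suc m') (suc s) =
      HasCard-≡ (HasCard-⇔ (HasCard-⊎ (positiveHead-card (suc m') s) zeroHead (λ { (x ∷ _) (_ , h) (_ , refl) → ℕP.<⇒≢ h refl }))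
                           (λ b → λ { (inj₁ (w , _)) → w ; (inj₂ (w , _)) → w })
                           (λ { (zero ∷ xs) w → inj₂ (w , refl) ; (suc x ∷ xs) w → inj₁ (w , s≤s z≤n) }))
                (trans (cong (λ z → z C s + (m' + suc s) C suc s) (sym (ℕP.+-suc m' s)))
                       (nCk+nC[k+1]≡[n+1]C[k+1] (m' + suc s) s))
      where
      zeroHead : HasCard (λ b → WeakComposition (suc m') (suc s) b × nth b 0 ≡ 0) ((m' + suc s) C suc s)
      zeroHead = HasCard-map (0 ∷_) (weakComposition-card m' (suc s))
        (λ x y _ _ e → ∷-injectiveʳ e)
        (λ b (lb , sb) → (cong suc lb , sb) , refl)
        (λ { (zero ∷ xs) ((lb , sb) , _) → xs , (ℕP.suc-injective lb , sb) , refl })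

    positiveHead-card : ∀ m' s → HasCard (λ b → WeakComposition m' (suc s) b × PositiveHead b) ((m' + s) C s)
    positiveHead-card m' s = HasCard-map incrHead (weakComposition-card m' s)
      (λ { (x ∷ xs) (y ∷ ys) _ _ e → cong₂ _∷_ (ℕP.suc-injective (∷-injectiveˡ e)) (∷-injectiveʳ e) })
      (λ { (x ∷ xs) (lb , sb) → (lb , cong suc sb) , s≤s z≤n })
      (λ { (suc x ∷ xs) ((lb , sb) , _) → (x ∷ xs) , (lb , ℕP.suc-injective sb) , refl })

module AlternatingPairs where

  open Preliminaries
  open import Data.Nat as ℕ using (ℕ; zero; suc; _<_; z≤n; s≤s; _+_; _*_)
  import Data.Nat.Properties as ℕP
  open import Data.Nat.Tactic.RingSolver as ℕSolver using ()
  open import Data.Integer as ℤ using (ℤ; +_)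
  import Data.Integer.Properties as ℤP
  open import Data.Integer.Tactic.RingSolver using (solve-∀)
  open import Data.List using (List; []; _∷_; length; replicate; zipWith)
  open import Data.List.Properties using (∷-injectiveˡ; ∷-injectiveʳ)
  open import Data.Nat.ListAction using (sum)
  open import Data.Product using (Σ; _×_; _,_)
  open import Relation.Binary.PropositionalEquality using (_≡_; refl; cong; cong₂; sym; trans)
  open import Relation.Binary.PropositionalEquality.Properties using (module ≡-Reasoning)
  open ≡-Reasoning

  infixl 6 _⊞_
  _⊞_ : List ℕ → List ℕ → List ℕ
  _⊞_ = zipWith _+_

  evens odds : ℕ → ℕ → List ℕ
  evens t zero = []
  evens t (suc n) = t ∷ odds t n
  odds t zero = []
  odds t (suc n) = 0 ∷ evens t n

  length-evens : ∀ t n → length (evens t n) ≡ n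
  length-odds : ∀ t n → length (odds t n) ≡ n
  length-evens t zero = refl
  length-evens t (suc n) = cong suc (length-odds t n)
  length-odds t zero = refl
  length-odds t (suc n) = cong suc (length-evens t n)

  sum-evens-odds : ∀ t n → sum (evens t n) + sum (odds t n) ≡ n * t
  sum-evens-odds t zero = refl
  sum-evens-odds t (suc n) = begin
    (t + sum (odds t n)) + (0 + sum (evens t n)) ≡⟨ regroup t (sum (odds t n)) (sum (evens t n)) ⟩
    t + (sum (evens t n) + sum (odds t n))       ≡⟨ cong (λ x → t + x) (sum-evens-odds t n) ⟩
    t + n * t                                    ∎
    where
    regroup : ∀ a b c → (a + b) + (0 + c) ≡ a + (c + b)
    regroup = ℕSolver.solve-∀

  length-⊞ : ∀ x y → length x ≡ length y → length (x ⊞ y) ≡ length x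
  length-⊞ [] [] e = refl
  length-⊞ (a ∷ x) (b ∷ y) e = cong suc (length-⊞ x y (ℕP.suc-injective e))

  sum-⊞ : ∀ x y → length x ≡ length y → sum (x ⊞ y) ≡ sum x + sum y
  sum-⊞ [] [] e = refl
  sum-⊞ (a ∷ x) (b ∷ y) e = trans (cong (λ s → (a + b) + s) (sum-⊞ x y (ℕP.suc-injective e))) (interchange a b (sum x) (sum y))
    where
    interchange : ∀ a b c d → (a + b) + (c + d) ≡ (a + c) + (b + d)
    interchange = ℕSolver.solve-∀

  nth-⊞ : ∀ x y → length x ≡ length y → ∀ k → nth (x ⊞ y) k ≡ nth x k + nth y k
  nth-⊞ [] [] e k = refl
  nth-⊞ (a ∷ x) (b ∷ y) e zero = refl
  nth-⊞ (a ∷ x) (b ∷ y) e (suc k) = nth-⊞ x y (ℕP.suc-injective e) k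

  ⊞-cancelʳ : ∀ x x' y → length x ≡ length y → length x' ≡ length y → x ⊞ y ≡ x' ⊞ y → x ≡ x'
  ⊞-cancelʳ [] [] [] _ _ _ = refl
  ⊞-cancelʳ (a ∷ x) (a' ∷ x') (b ∷ y) l l' e =
    cong₂ _∷_ (ℕP.+-cancelʳ-≡ b a a' (∷-injectiveˡ e)) (⊞-cancelʳ x x' y (ℕP.suc-injective l) (ℕP.suc-injective l') (∷-injectiveʳ e))

  replicate-0-⊞ : ∀ y → replicate (length y) 0 ⊞ y ≡ y
  replicate-0-⊞ [] = refl
  replicate-0-⊞ (a ∷ y) = cong (a ∷_) (replicate-0-⊞ y)

  AlternatingDifference-swap : ∀ {n u v C} → AlternatingDifference n u v C → AlternatingDifference n v u (ℤ.- C)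
  AlternatingDifference-swap {u = u} {v} {C} h k k<n = trans (negate (+ nth u k) (+ nth v k))
      (trans (cong ℤ.-_ (h k k<n)) (ℤP.neg-distribʳ-* (altSign k) C))
    where
    negate : ∀ a b → b ℤ.- a ≡ ℤ.- (a ℤ.- b)
    negate = solve-∀

  neg-shift : ∀ a c → a ℤ.* (ℤ.- c) ≡ (ℤ.- a) ℤ.* c
  neg-shift = solve-∀

  -- Shifting the index by one flips altSign, which the swap of u and v undoes.
  AlternatingDifference-∷ : ∀ {n a b u v C} → + a ℤ.- + b ≡ C → AlternatingDifference n v u C →
                            AlternatingDifference (suc n) (a ∷ u) (b ∷ v) C
  AlternatingDifference-∷ {C = C} head _ zero _ = trans head (sym (ℤP.*-identityˡ C))
  AlternatingDifference-∷ {u = u} {v = v} {C = C} _ h (suc k) (s≤s k<n) =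
    trans (AlternatingDifference-swap {u = v} {u} h k k<n) (neg-shift (altSign k) C)

  AlternatingDifference-tail : ∀ {n a b u v C} → AlternatingDifference (suc n) (a ∷ u) (b ∷ v) C →
                               AlternatingDifference n v u C
  AlternatingDifference-tail {u = u} {v = v} {C = C} h k k<n = trans
      (AlternatingDifference-swap {u = u} {v} (λ j j<n → trans (h (suc j) (s≤s j<n)) (sym (neg-shift (altSign j) C))) k k<n)
    (cong (altSign k ℤ.*_) (ℤP.neg-involutive C))

  AlternatingDifference-⊞ : ∀ t b → AlternatingDifference (length b) (b ⊞ evens t (length b)) (b ⊞ odds t (length b)) (+ t)
  AlternatingDifference-⊞ t [] k ()
  AlternatingDifference-⊞ t (x ∷ b) = AlternatingDifference-∷ (head x) (AlternatingDifference-⊞ t b)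
    where
    head : ∀ x → + (x + t) ℤ.- + (x + 0) ≡ + t
    head x = trans (cong₂ (λ a c → a ℤ.- c) (ℤP.pos-+ x t) (ℤP.pos-+ x 0)) (cancel (+ x) (+ t))
      where
      cancel : ∀ a c → (a ℤ.+ c) ℤ.- (a ℤ.+ + 0) ≡ c
      cancel = solve-∀

  decompose : ∀ t n u v → length u ≡ n → length v ≡ n → AlternatingDifference n u v (+ t) →
              Σ (List ℕ) λ b → (length b ≡ n) × (u ≡ b ⊞ evens t n) × (v ≡ b ⊞ odds t n)
  decompose t zero [] [] _ _ _ = [] , refl , refl , refl
  decompose t (suc n) (a ∷ u) (b ∷ v) lu lv h
    with decompose t n v u (ℕP.suc-injective lv) (ℕP.suc-injective lu) (AlternatingDifference-tail h)
  ... | c , lc , v≡ , u≡ = (b ∷ c) , cong suc lc , cong₂ _∷_ a≡b+t u≡ , cong₂ _∷_ (sym (ℕP.+-identityʳ b)) v≡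
    where
    a≡b+t : a ≡ b + t
    a≡b+t = ℤP.+-injective (begin
      + a                   ≡⟨ shift (+ a) (+ b) ⟩
      + b ℤ.+ (+ a ℤ.- + b) ≡⟨ cong (λ d → + b ℤ.+ d) (trans (h 0 (s≤s z≤n)) (ℤP.*-identityˡ (+ t))) ⟩
      + (b + t)             ∎)
      where
      shift : ∀ x y → x ≡ y ℤ.+ (x ℤ.- y)
      shift = solve-∀

module Classification (p' n : ℕ.ℕ) (n≥2 : 2 ℕ.≤ n) where
  open import Data.Nat as ℕ using (ℕ; zero; suc; _≤_; _<_; z≤n; s≤s; _+_; _*_; _∸_; _/_; _%_)

  open Cardinality
  open WeakCompositions
  open AlternatingPairs
  open Preliminaries
  import Data.Nat.Properties as ℕP
  import Data.Nat.DivMod as DM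
  import Relation.Nullary.Decidable
  open import Data.Nat.Combinatorics using (_C_)
  open import Data.Nat.Divisibility using (_∣?_; divides) renaming (_∣_ to _∣ℕ_)
  open import Data.Integer as ℤ using (ℤ; +_; -[1+_])
  import Data.Integer.Properties as ℤP
  open import Data.List as List using (List; []; _∷_; _++_; map; length; replicate; zipWith; upTo; concatMap)
  import Data.List.Properties as DLP
  open import Data.Nat.ListAction using (sum)
  open import Data.List.Membership.Propositional using (_∈_)
  import Data.List.Membership.Propositional.Properties as MP
  import Data.List.Relation.Unary.Unique.Propositional.Properties as UP
  open import Data.List.Relation.Unary.Unique.Propositional using (Unique)
  open import Data.Product using (Σ; _×_; _,_; proj₁; proj₂)
  open import Data.Sum using (_⊎_; inj₁; inj₂)
  open import Data.Empty using (⊥; ⊥-elim)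
  open import Data.Bool using (if_then_else_; true; false)
  open import Relation.Nullary using (¬_; yes; no; does)
  open import Relation.Binary.PropositionalEquality as Eq using (_≡_; refl; cong; cong₂; sym; trans; subst)
  open Eq.≡-Reasoning
  open import Data.Nat.Tactic.RingSolver using (solve-∀)

  p : ℕ
  p = suc p'

  Pair : Set
  Pair = List ℕ × List ℕ

  -- A good pair has u - v = C (1, -1, 1, …). C = 0 gives the diagonal term of the formula; C = t > 0 and
  -- C = -t < 0 give u, v = b + t(1,0,1,…), b + t(0,1,0,…) in some order with 2 sum b + p t = n, counted by
  -- the two sums (u must keep a positive head); C = t > 0 with b = 0 is the term δ.
  plusPair minusPair : ℕ → List ℕ → Pair
  plusPair t b = (b ⊞ evens t p , b ⊞ odds t p)
  minusPair t b = (b ⊞ odds t p , b ⊞ evens t p)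

  DiagonalBase : List ℕ → Set
  DiagonalBase b = (length b ≡ p) × (sum b + sum b ≡ n) × PositiveHead b

  Diagonal : Pair → Set
  Diagonal uv = Σ (List ℕ) λ b → DiagonalBase b × (uv ≡ (b , b))

  Plus Minus : ℕ → ℕ → Pair → Set
  Plus s t uv = Σ (List ℕ) λ b → WeakComposition p' s b × (uv ≡ plusPair t b)
  Minus s t uv = Σ (List ℕ) λ b → (WeakComposition p' s b × PositiveHead b) × (uv ≡ minusPair t b)

  Pure : Pair → Set
  Pure uv = Σ ℕ λ t → (p * t ≡ n) × (uv ≡ (evens t p , odds t p))

  PlusSolution MinusSolution : ℕ → ℕ → Pair → Set
  PlusSolution s t uv = (2 * s + p * t ≡ n) × Plus s t uv
  MinusSolution s t uv = (2 * s + p * t ≡ n) × Minus s t uv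

  PlusFamily MinusFamily : Pair → Set
  PlusFamily uv = Σ ℕ λ s → s ∈ oneTo n × (Σ ℕ λ t → t ∈ oneTo n × PlusSolution s t uv)
  MinusFamily uv = Σ ℕ λ s → s ∈ oneTo n × (Σ ℕ λ t → t ∈ oneTo n × MinusSolution s t uv)

  nth0-evens : ∀ t b → length b ≡ p → nth (b ⊞ evens t p) 0 ≡ nth b 0 + t
  nth0-evens t b lb = nth-⊞ b (evens t p) (trans lb (sym (length-evens t p))) 0
  nth0-odds : ∀ t b → length b ≡ p → nth (b ⊞ odds t p) 0 ≡ nth b 0 + 0
  nth0-odds t b lb = nth-⊞ b (odds t p) (trans lb (sym (length-odds t p))) 0

  Plus-head : ∀ {s t u v} → Plus s t (u , v) → nth u 0 ≡ nth v 0 + t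
  Plus-head {s} {t} (b , (lb , _) , refl) = trans (nth0-evens t b lb) (cong (λ z → z + t) (sym (trans (nth0-odds t b lb) (ℕP.+-identityʳ _))))

  Minus-head : ∀ {s t u v} → Minus s t (u , v) → nth v 0 ≡ nth u 0 + t
  Minus-head {s} {t} ((b , ((lb , _) , _) , refl)) = trans (nth0-evens t b lb)
      (cong (λ z → z + t) (sym (trans (nth0-odds t b lb) (ℕP.+-identityʳ _))))

  ∈oneTo⁺ : ∀ {s} → 1 ≤ s → s ≤ n → s ∈ oneTo n
  ∈oneTo⁺ {suc s} _ (s≤s le) = MP.∈-map⁺ suc (MP.∈-upTo⁺ (s≤s le))

  ∈oneTo⁻ : ∀ {s} → s ∈ oneTo n → 1 ≤ s
  ∈oneTo⁻ i with MP.∈-map⁻ suc i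
  ... | x , _ , refl = s≤s z≤n

  unique-oneTo : Unique (oneTo n)
  unique-oneTo = UP.map⁺ ℕP.suc-injective (UP.upTo⁺ n)

  m≢m+suc : ∀ m t → 1 ≤ t → ¬ m ≡ m + t
  m≢m+suc m (suc t) _ e = ℕP.m≢1+n+m m (trans e (trans (ℕP.+-comm m (suc t)) refl))

  x+x≢1+y+y : ∀ x y → ¬ x + x ≡ suc (y + y)
  x+x≢1+y+y zero y ()
  x+x≢1+y+y (suc x) zero e = ℕP.m+1+n≢0 x (ℕP.suc-injective e)
  x+x≢1+y+y (suc x) (suc y) e = x+x≢1+y+y x y
      (ℕP.suc-injective (trans (sym (ℕP.+-suc x x)) (trans (ℕP.suc-injective e) (cong suc (ℕP.+-suc y y)))))

  x*2≡x+x : ∀ x → x * 2 ≡ x + x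
  x*2≡x+x x = trans (ℕP.*-comm x 2) (cong (λ z → x + z) (ℕP.+-identityʳ x))

  DiagonalBase-card : HasCard DiagonalBase ((1 ∸ n % 2) * ((p + n / 2 ∸ 2) C (n / 2 ∸ 1)))
  DiagonalBase-card with n % 2 | n / 2 | DM.m≡m%n+[m/n]*n n 2 | DM.m%n<n n 2
  ... | 0 | 0 | e | _ = ⊥-elim (ℕP.n≮0 (subst (2 ≤_) e n≥2))
  ... | 0 | suc h' | e | _ = HasCard-≡ (HasCard-⇔ (positiveHead-card p' h') to from) count
    where
    to : ∀ b → WeakComposition p' (suc h') b × PositiveHead b → DiagonalBase b
    to b ((lb , sb) , hb) = lb , trans (sym (x*2≡x+x (sum b))) (trans (cong (_* 2) sb) (sym e)) , hb
    from : ∀ b → DiagonalBase b → WeakComposition p' (suc h') b × PositiveHead b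
    from b (lb , sb , hb) = (lb , ℕP.*-cancelʳ-≡ (sum b) (suc h') 2 (trans (x*2≡x+x (sum b)) (trans sb e))) , hb
    count : (p' + h') C h' ≡ 1 * ((p + suc h' ∸ 2) C (suc h' ∸ 1))
    count = trans (cong (λ z → z C h') (cong (_∸ 1) (sym (ℕP.+-suc p' h')))) (sym (ℕP.+-identityʳ _))
  ... | 1 | h | e | _ = HasCard-∅ (λ b (lb , sb , _) → x+x≢1+y+y (sum b) h (trans sb (trans e (cong suc (x*2≡x+x h)))))
  ... | suc (suc _) | _ | _ | s≤s (s≤s ())

  Diagonal-card : HasCard Diagonal (parityFactor n * ((p + n / 2 ∸ 2) C (n / 2 ∸ 1)))
  Diagonal-card = HasCard-map (λ b → (b , b)) DiagonalBase-card (λ x y _ _ e → cong proj₁ e) (λ b w → b , w , refl)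
      (λ { uv (b , w , refl) → b , w , refl })

  sum-concatMap : ∀ {A : Set} (h : A → List ℕ) xs → sum (concatMap h xs) ≡ sum (map (λ x → sum (h x)) xs)
  sum-concatMap h [] = refl
  sum-concatMap h (x ∷ xs) = trans (Data.Nat.ListAction.Properties.sum-++ (h x) (concatMap h xs))
      (cong (λ z → sum (h x) + z) (sum-concatMap h xs))
    where import Data.Nat.ListAction.Properties

  module Sums (f : ℕ → ℕ) where
    term : ℕ → ℕ → List ℕ
    term s t = if does (2 * s + p * t ℕ.≟ n) then f s ∷ [] else []
    count : ℕ → ℕ → ℕ
    count s t = sum (term s t)
    rowCount : ℕ → ℕ
    rowCount s = sum (map (count s) (oneTo n))
    count-solution : ∀ s t → 2 * s + p * t ≡ n → count s t ≡ f s + 0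
    count-solution s t e = cong (λ b → sum (if b then f s ∷ [] else [])) (Relation.Nullary.Decidable.dec-true (2 * s + p * t ℕ.≟ n) e)
    count-nonsolution : ∀ s t → ¬ 2 * s + p * t ≡ n → count s t ≡ 0
    count-nonsolution s t ne = cong (λ b → sum (if b then f s ∷ [] else [])) (Relation.Nullary.Decidable.dec-false (2 * s + p * t ℕ.≟ n) ne)
    sumST≡ : sumST n p f ≡ sum (map rowCount (oneTo n))
    sumST≡ = trans (sum-concatMap (λ s → concatMap (term s) (oneTo n)) (oneTo n))
                     (cong sum (DLP.map-cong (λ s → sum-concatMap (term s) (oneTo n)) (oneTo n)))

    module Union (R : ℕ → ℕ → Pair → Set)
               (R-card : ∀ s t → s ∈ oneTo n → HasCard (R s t) (count s t))
               (solution : ∀ s t uv → R s t uv → (2 * s + p * t ≡ n))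
               (t-determined : ∀ s s' t t' uv → R s t uv → R s' t' uv → t ≡ t') where
      t-unique : ∀ s t t' uv → t ∈ oneTo n → t' ∈ oneTo n → R s t uv → R s t' uv → t ≡ t'
      t-unique s t t' uv _ _ r r' = t-determined s s t t' uv r r'
      s-unique : ∀ s s' uv → s ∈ oneTo n → s' ∈ oneTo n → (Σ ℕ λ t → t ∈ oneTo n × R s t uv) → (Σ ℕ λ t → t ∈ oneTo n × R s' t uv) → s ≡ s'
      s-unique s s' uv _ _ (t , _ , r) (t' , _ , r') with t-determined s s' t t' uv r r'
      ... | refl = ℕP.*-cancelˡ-≡ s s' 2 (ℕP.+-cancelʳ-≡ (p * t) (2 * s) (2 * s') (trans (solution s t uv r) (sym (solution s' t uv r'))))
      card : HasCard (λ uv → Σ ℕ λ s → s ∈ oneTo n × (Σ ℕ λ t → t ∈ oneTo n × R s t uv)) (sumST n p f)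
      card = HasCard-≡ (HasCard-Union (oneTo n) (λ s uv → Σ ℕ λ t → t ∈ oneTo n × R s t uv) rowCount unique-oneTo
                   (λ s si → HasCard-Union (oneTo n) (R s) (count s) unique-oneTo (λ t _ → R-card s t si) (t-unique s))
                   s-unique) (sym sumST≡)

  plusPair-injective : ∀ t b b' → length b ≡ p → length b' ≡ p → plusPair t b ≡ plusPair t b' → b ≡ b'
  plusPair-injective t b b' lb lb' e = ⊞-cancelʳ b b' (evens t p) (trans lb (sym (length-evens t p)))
      (trans lb' (sym (length-evens t p))) (cong proj₁ e)

  minusPair-injective : ∀ t b b' → length b ≡ p → length b' ≡ p → minusPair t b ≡ minusPair t b' → b ≡ b'
  minusPair-injective t b b' lb lb' e = ⊞-cancelʳ b b' (odds t p) (trans lb (sym (length-odds t p)))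
      (trans lb' (sym (length-odds t p))) (cong proj₁ e)

  module PlusSums = Sums (λ s → (p + s ∸ 1) C s)
  module MinusSums = Sums (λ s → (p + s ∸ 2) C (s ∸ 1))

  PlusSolution-card : ∀ s t → s ∈ oneTo n → HasCard (PlusSolution s t) (PlusSums.count s t)
  PlusSolution-card s t _ with 2 * s + p * t ℕ.≟ n
  ... | no ne = HasCard-≡ (HasCard-∅ (λ uv (e , _) → ne e)) (sym (PlusSums.count-nonsolution s t ne))
  ... | yes e = HasCard-≡ (HasCard-map (plusPair t) (weakComposition-card p' s) (λ b b' (lb , _) (lb' , _) → plusPair-injective t b b' lb lb')
                        (λ b w → e , b , w , refl) (λ { uv (_ , b , w , eq) → b , w , sym eq }))
                     (trans (sym (ℕP.+-identityʳ _)) (sym (PlusSums.count-solution s t e)))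

  MinusSolution-card : ∀ s t → s ∈ oneTo n → HasCard (MinusSolution s t) (MinusSums.count s t)
  MinusSolution-card s t si with 2 * s + p * t ℕ.≟ n | ∈oneTo⁻ si
  ... | no ne | _ = HasCard-≡ (HasCard-∅ (λ uv (e , _) → ne e)) (sym (MinusSums.count-nonsolution s t ne))
  ... | yes e | s≤s {n = s'} _ = HasCard-≡ (HasCard-map (minusPair t) (positiveHead-card p' s')
      (λ b b' ((lb , _) , _) ((lb' , _) , _) → minusPair-injective t b b' lb lb')
                        (λ b w → e , b , w , refl) (λ { uv (_ , b , w , eq) → b , w , sym eq }))
                     (trans (cong (λ z → z C s') (cong (_∸ 1) (sym (ℕP.+-suc p' s'))))
                         (trans (sym (ℕP.+-identityʳ _)) (sym (MinusSums.count-solution s t e))))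

  PlusFamily-card : HasCard PlusFamily (sumST n p (λ s → (p + s ∸ 1) C s))
  PlusFamily-card = PlusSums.Union.card PlusSolution PlusSolution-card (λ s t uv r → proj₁ r)
    (λ { s s' t t' (u , v) (_ , kp) (_ , kp') → ℕP.+-cancelˡ-≡ (nth v 0) t t' (trans (sym (Plus-head kp)) (Plus-head kp')) })

  MinusFamily-card : HasCard MinusFamily (sumST n p (λ s → (p + s ∸ 2) C (s ∸ 1)))
  MinusFamily-card = MinusSums.Union.card MinusSolution MinusSolution-card (λ s t uv r → proj₁ r)
    (λ { s s' t t' (u , v) (_ , km) (_ , km') → ℕP.+-cancelˡ-≡ (nth u 0) t t' (trans (sym (Minus-head km)) (Minus-head km')) })

  Pure-card : HasCard Pure (delta p n)
  Pure-card with p ∣? n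
  ... | yes d@(divides t e) = HasCard-≡ (HasCard-1 (evens t p , odds t p) (t , trans (ℕP.*-comm p t) (sym e) , refl)
          (λ { uv (t' , e' , refl) → cong (λ z → (evens z p , odds z p)) (ℕP.*-cancelˡ-≡ t' t p (trans e' (trans e (ℕP.*-comm t p)))) }))
          (sym (cong (λ b → if b then 1 else 0) (Relation.Nullary.Decidable.dec-true (p ∣? n) d)))
  ... | no nd = HasCard-≡ (HasCard-∅ (λ uv (t , e , _) → nd (divides t (trans (sym e) (ℕP.*-comm p t)))))
          (sym (cong (λ b → if b then 1 else 0) (Relation.Nullary.Decidable.dec-false (p ∣? n) nd)))

  Good : Pair → Set
  Good (u , v) = (length u ≡ p) × (length v ≡ p) × (sum u + sum v ≡ n) × PositiveHead u × Σ ℤ (AlternatingDifference p u v)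

  sum-plusPair : ∀ t b → length b ≡ p → sum (b ⊞ evens t p) + sum (b ⊞ odds t p) ≡ 2 * sum b + p * t
  sum-plusPair t b lb = begin
    sum (b ⊞ evens t p) + sum (b ⊞ odds t p)             ≡⟨ cong₂ _+_ (sum-⊞ b (evens t p) (trans lb (sym (length-evens t p))))
                                                                        (sum-⊞ b (odds t p) (trans lb (sym (length-odds t p)))) ⟩
    (sum b + sum (evens t p)) + (sum b + sum (odds t p)) ≡⟨ regroup (sum b) (sum (evens t p)) (sum (odds t p)) ⟩
    2 * sum b + (sum (evens t p) + sum (odds t p))       ≡⟨ cong (λ z → 2 * sum b + z) (sum-evens-odds t p) ⟩
    2 * sum b + p * t                                    ∎
    where
    regroup : ∀ s e o → (s + e) + (s + o) ≡ 2 * s + (e + o)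
    regroup = solve-∀

  AlternatingDifference-plusPair : ∀ t b → length b ≡ p → AlternatingDifference p (b ⊞ evens t p) (b ⊞ odds t p) (+ t)
  AlternatingDifference-plusPair t b lb = subst (λ m → AlternatingDifference m (b ⊞ evens t m) (b ⊞ odds t m) (+ t)) lb
      (AlternatingDifference-⊞ t b)

  length-plusPair : ∀ t b → length b ≡ p → (length (b ⊞ evens t p) ≡ p) × (length (b ⊞ odds t p) ≡ p)
  length-plusPair t b lb = trans (length-⊞ b (evens t p) (trans lb (sym (length-evens t p)))) lb ,
                           trans (length-⊞ b (odds t p) (trans lb (sym (length-odds t p)))) lb

  good-plus : ∀ t b → length b ≡ p → 1 ≤ t → 2 * sum b + p * t ≡ n → Good (plusPair t b)
  good-plus t b lb t≥1 e = proj₁ (length-plusPair t b lb) , proj₂ (length-plusPair t b lb) ,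
                           trans (sum-plusPair t b lb) e ,
                           subst (1 ≤_) (sym (nth0-evens t b lb)) (ℕP.≤-trans t≥1 (ℕP.m≤n+m t (nth b 0))) ,
                           + t , AlternatingDifference-plusPair t b lb

  good-minus : ∀ t b → length b ≡ p → PositiveHead b → 2 * sum b + p * t ≡ n → Good (minusPair t b)
  good-minus t b lb h e = proj₂ (length-plusPair t b lb) , proj₁ (length-plusPair t b lb) ,
                          trans (ℕP.+-comm (sum (b ⊞ odds t p)) _) (trans (sum-plusPair t b lb) e) ,
                          subst (1 ≤_) (sym (trans (nth0-odds t b lb) (ℕP.+-identityʳ _))) h ,
                          ℤ.- + t , AlternatingDifference-swap {u = b ⊞ evens t p} {b ⊞ odds t p} (AlternatingDifference-plusPair t b lb)

  good-diagonal : ∀ b → DiagonalBase b → Good (b , b)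
  good-diagonal b (lb , sb , hb) = lb , lb , sb , hb , + 0 ,
    λ k _ → trans (ℤP.+-inverseʳ (+ nth b k)) (sym (ℤP.*-zeroʳ (altSign k)))

  nth0≤sum : ∀ b → nth b 0 ≤ sum b
  nth0≤sum [] = z≤n
  nth0≤sum (x ∷ b) = ℕP.m≤m+n x (sum b)

  plusPair-replicate-0 : ∀ t → plusPair t (replicate p 0) ≡ (evens t p , odds t p)
  plusPair-replicate-0 t = cong₂ _,_ (trans (cong (λ k → replicate k 0 ⊞ evens t p) (sym (length-evens t p))) (replicate-0-⊞ (evens t p)))
                     (trans (cong (λ k → replicate k 0 ⊞ odds t p) (sym (length-odds t p))) (replicate-0-⊞ (odds t p)))

  t≤pt : ∀ t → t ≤ p * t
  t≤pt t = ℕP.m≤m+n t (p' * t)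

  s≤n : ∀ s t → 2 * s + p * t ≡ n → s ≤ n
  s≤n s t e = subst (s ≤_) e (ℕP.≤-trans (ℕP.m≤m+n s (s + 0)) (ℕP.m≤m+n (2 * s) (p * t)))

  t≤n : ∀ s t → 2 * s + p * t ≡ n → t ≤ n
  t≤n s t e = subst (t ≤_) e (ℕP.≤-trans (t≤pt t) (ℕP.m≤n+m (p * t) (2 * s)))

  Pure⇒t≥1 : ∀ t → p * t ≡ n → 1 ≤ t
  Pure⇒t≥1 zero e0 = ⊥-elim (ℕP.<⇒≱ n≥2 (subst (_≤ 1) (trans (sym (ℕP.*-zeroʳ p)) e0) z≤n))
  Pure⇒t≥1 (suc _) _ = s≤s z≤n

  InFamilies : Pair → Set
  InFamilies uv = ((Diagonal uv ⊎ PlusFamily uv) ⊎ MinusFamily uv) ⊎ Pure uv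

  classify : ∀ u v d → length u ≡ p → length v ≡ p → sum u + sum v ≡ n → PositiveHead u →
             AlternatingDifference p u v d → InFamilies (u , v)
  classify u v (+ zero) lu lv su hu h = inj₁ (inj₁ (inj₁ (u , (lu , subst (λ w → sum u + sum w ≡ n) (sym u≡v) su , hu) , cong (u ,_) (sym u≡v))))
    where
    u≡v : u ≡ v
    u≡v = nth-ext u v (trans lu (sym lv)) (λ k lt → ℤP.+-injective (ℤP.i-j≡0⇒i≡j _ _ (trans (h k (subst (k <_) lu lt)) (ℤP.*-zeroʳ (altSign k)))))
  classify u v (+ suc t') lu lv su hu h with decompose (suc t') p u v lu lv h
  ... | b , lb , eu , ev = res
    where
    t = suc t'
    pe : (u , v) ≡ plusPair t b
    pe = cong₂ _,_ eu ev
    sumeq : 2 * sum b + p * t ≡ n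
    sumeq = trans (sym (sum-plusPair t b lb)) (trans (cong₂ (λ x y → sum x + sum y) (sym eu) (sym ev)) su)
    res : InFamilies (u , v)
    res with sum b in sb
    ... | zero = inj₂ (t , trans (sym (ℕP.+-identityˡ (p * t))) (subst (λ z → 2 * z + p * t ≡ n) sb sumeq) ,
                       trans pe (trans (cong (plusPair t) (trans (sum≡0⇒replicate b sb) (cong (λ k → replicate k 0) lb)))
                           (plusPair-replicate-0 t)))
    ... | suc s'' = inj₁ (inj₁ (inj₂ (suc s'' , ∈oneTo⁺ (s≤s z≤n) (s≤n (suc s'') t se) ,
                       t , ∈oneTo⁺ (s≤s z≤n) (t≤n (suc s'') t se) , se , b , (lb , sb) , pe)))
      where
      se : 2 * suc s'' + p * t ≡ n
      se = subst (λ z → 2 * z + p * t ≡ n) sb sumeq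
  classify u v -[1+ t' ] lu lv su hu h with decompose (suc t') p v u lv lu (AlternatingDifference-swap {u = u} {v} h)
  ... | b , lb , ev , eu = inj₁ (inj₂ (sum b , ∈oneTo⁺ (ℕP.≤-trans hb (nth0≤sum b)) (s≤n (sum b) t sumeq) ,
                             t , ∈oneTo⁺ (s≤s z≤n) (t≤n (sum b) t sumeq) , sumeq , b , ((lb , refl) , hb) , cong₂ _,_ eu ev))
    where
    t = suc t'
    hb : 1 ≤ nth b 0
    hb = subst (1 ≤_) (trans (cong (λ w → nth w 0) eu) (trans (nth0-odds t b lb) (ℕP.+-identityʳ _))) hu
    sumeq : 2 * sum b + p * t ≡ n
    sumeq = trans (sym (sum-plusPair t b lb))
        (trans (ℕP.+-comm (sum (b ⊞ evens t p)) _) (trans (cong₂ (λ x y → sum x + sum y) (sym eu) (sym ev)) su))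

  from : ∀ uv → Good uv → InFamilies uv
  from (u , v) (lu , lv , su , hu , d , h) = classify u v d lu lv su hu h

  to : ∀ uv → InFamilies uv → Good uv
  to uv (inj₁ (inj₁ (inj₁ (b , w , refl)))) = good-diagonal b w
  to uv (inj₁ (inj₁ (inj₂ (s , si , t , ti , e , b , (lb , sb) , refl)))) = good-plus t b lb (∈oneTo⁻ ti)
      (subst (λ z → 2 * z + p * t ≡ n) (sym sb) e)
  to uv (inj₁ (inj₂ (s , si , t , ti , e , b , ((lb , sb) , hb) , refl))) = good-minus t b lb hb (subst (λ z → 2 * z + p * t ≡ n) (sym sb) e)
  to uv (inj₂ (t , e , refl)) = subst Good (plusPair-replicate-0 t) (good-plus t (replicate p 0) (DLP.length-replicate p) t≥1 e')
    where
    t≥1 : 1 ≤ t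
    t≥1 = Pure⇒t≥1 t e
    e' : 2 * sum (replicate p 0) + p * t ≡ n
    e' = trans (cong (λ z → 2 * z + p * t) (sum-replicate-zero p)) e

  Diagonal-head : ∀ {u v} → Diagonal (u , v) → nth u 0 ≡ nth v 0
  Diagonal-head (b , _ , refl) = refl

  Diagonal∩PlusFamily : ∀ uv → Diagonal uv → PlusFamily uv → ⊥
  Diagonal∩PlusFamily (u , v) k0 (s , si , t , ti , _ , kp) = m≢m+suc (nth v 0) t (∈oneTo⁻ ti) (trans (sym (Diagonal-head k0)) (Plus-head kp))

  MinusFamily-disjoint : ∀ uv → Diagonal uv ⊎ PlusFamily uv → MinusFamily uv → ⊥
  MinusFamily-disjoint (u , v) (inj₁ k0) (s , si , t , ti , _ , km) = m≢m+suc (nth u 0) t (∈oneTo⁻ ti) (trans (Diagonal-head k0) (Minus-head km))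
  MinusFamily-disjoint (u , v) (inj₂ (s , si , t , ti , _ , kp)) (s' , si' , t' , ti' , _ , km) =
    m≢m+suc (nth u 0) (t' + t) (ℕP.≤-trans (∈oneTo⁻ ti') (ℕP.m≤m+n t' t))
      (trans (Plus-head kp) (trans (cong (_+ t) (Minus-head km)) (ℕP.+-assoc (nth u 0) t' t)))

  Pure-disjoint : ∀ uv → (Diagonal uv ⊎ PlusFamily uv) ⊎ MinusFamily uv → Pure uv → ⊥
  Pure-disjoint uv (inj₁ (inj₁ (b , _ , e))) (t , et , refl) =
    ℕP.<⇒≢ (Pure⇒t≥1 t et) (sym (trans (cong (λ w → nth (proj₁ w) 0) e) (sym (cong (λ w → nth (proj₂ w) 0) e))))
  Pure-disjoint uv (inj₁ (inj₂ (s , si , t' , ti , e , b , (lb , sb) , eq))) (t , et , e') = ℕP.<⇒≱ (∈oneTo⁻ si)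
      (ℕP.≤-reflexive (trans (sym sb) sb0))
    where
    solution : nth (evens t p) 0 ≡ nth (odds t p) 0 + t'
    solution = Plus-head {s} {t'} {evens t p} {odds t p} (b , (lb , sb) , trans (sym e') eq)
    tt : t' ≡ t
    tt = sym solution
    eqE : evens t p ≡ b ⊞ evens t p
    eqE = trans (cong proj₁ (trans (sym e') eq)) (cong (λ z → b ⊞ evens z p) tt)
    sb0 : sum b ≡ 0
    sb0 = ℕP.+-cancelʳ-≡ (sum (evens t p)) (sum b) 0 (trans (sym (sum-⊞ b (evens t p) (trans lb (sym (length-evens t p))))) (sym (cong sum eqE)))
  Pure-disjoint (u , v) (inj₂ (s , si , t' , ti , e , km)) (t , et , refl) = ℕP.<⇒≱ (∈oneTo⁻ ti)
      (ℕP.≤-reflexive (ℕP.m+n≡0⇒n≡0 t (sym (Minus-head km))))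

  Good-card : HasCard Good (rhs n p)
  Good-card = HasCard-⇔ (HasCard-⊎ (HasCard-⊎ (HasCard-⊎ Diagonal-card PlusFamily-card Diagonal∩PlusFamily) MinusFamily-card
      MinusFamily-disjoint) Pure-card Pure-disjoint) to from

module Correspondence {c ℓ : Level} (F : CharZeroField c ℓ) (ζ : CharZeroField.Carrier F) (p' n : ℕ.ℕ) (n≥2 : 2 ℕ.≤ n)
    (pp : Prime (ℕ.suc p')) (odd : ¬ 2 ∣ℕ ℕ.suc p') (prim : IsPrimitiveRoot F (2 ℕ.* ℕ.suc p') ζ) where

  open CharZeroField F
  open Preliminaries using (nth)
  open Evaluation F using (ev; ι)
  open PrimitiveRoot2p F ζ p' pp odd prim using (vanishing⇒alternating; alternating⇒vanishing)
  open MultiplicityVector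
  open Cardinality using (HasCard-map)
  open WeakCompositions using (PositiveHead)
  open Classification p' n n≥2 using (Pair; Good; Good-card; p)
  open import Relation.Binary.Reasoning.Setoid setoid
  open import Data.Nat as ℕ using (ℕ; zero; suc; _≤_)
  import Data.Nat.Properties as ℕP
  open import Data.Nat.ListAction using (sum)
  open import Data.Nat.ListAction.Properties using (sum-++)
  open import Data.Integer as ℤ using (+_)
  open import Data.Fin as Fin using (Fin; toℕ)
  open import Data.Fin.Properties using (≤-totalOrder)
  open import Data.List using (List; []; _∷_; _++_; map; length; replicate; take; drop; foldr)
  import Data.List.Properties as DLP
  open import Data.List.Relation.Unary.Sorted.TotalOrder using (Sorted)
  open import Data.Vec using (Vec)
  import Data.Vec.Properties as VP
  open import Data.Product using (Σ; _×_; _,_)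
  open import Relation.Binary.PropositionalEquality as Eq using (_≡_)

  q : ℕ
  q = 2 ℕ.* suc p'

  powerSum : ∀ {m} → List (Fin m) → Carrier
  powerSum = foldr (λ a acc → pow ζ (toℕ a) + acc) 0#

  powerSum-++ : ∀ {m} (l₁ l₂ : List (Fin m)) → powerSum (l₁ ++ l₂) ≈ powerSum l₁ + powerSum l₂
  powerSum-++ [] l₂ = sym (+-identityˡ _)
  powerSum-++ (a ∷ l₁) l₂ = trans (+-congˡ (powerSum-++ l₁ l₂)) (sym (+-assoc _ _ _))

  powerSum-replicate-zero : ∀ {m} k → powerSum (replicate k (Fin.zero {m})) ≈ ι (+ k)
  powerSum-replicate-zero zero = refl
  powerSum-replicate-zero (suc k) = +-congˡ (powerSum-replicate-zero k)

  powerSum-map-suc : ∀ {m} (l : List (Fin m)) → powerSum (map Fin.suc l) ≈ ζ * powerSum l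
  powerSum-map-suc [] = sym (zeroʳ ζ)
  powerSum-map-suc (a ∷ l) = trans (+-congˡ (powerSum-map-suc l)) (sym (distribˡ ζ _ _))

  powerSum-expand : ∀ m cs → length cs ≡ m → powerSum (expand m cs) ≈ ev ζ (map +_ cs)
  powerSum-expand zero [] _ = refl
  powerSum-expand (suc m) (k ∷ cs) lc = begin
    powerSum (replicate k Fin.zero ++ map Fin.suc (expand m cs))               ≈⟨ powerSum-++ (replicate k Fin.zero) _ ⟩
    powerSum (replicate k (Fin.zero {m})) + powerSum (map Fin.suc (expand m cs))
        ≈⟨ +-cong (powerSum-replicate-zero k) (powerSum-map-suc (expand m cs)) ⟩
    ι (+ k) + ζ * powerSum (expand m cs)                                        ≈⟨ +-congˡ (*-congˡ (powerSum-expand m cs (ℕP.suc-injective lc))) ⟩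
    ι (+ k) + ζ * ev ζ (map +_ cs)                                              ∎

  -- A sorted vector over ℤ_q is its multiplicity vector, split into the halves u (residues < p) and v.
  toVector : Pair → Vec (Fin q) n
  toVector (u , v) = toVecOfLength n (expand q (u ++ v))

  length-++-halves : ∀ (u v : List ℕ) → length u ≡ p → length v ≡ p → length (u ++ v) ≡ q
  length-++-halves u v lu lv = Eq.trans (DLP.length-++ u) (Eq.trans (Eq.cong₂ ℕ._+_ lu lv) (Eq.cong (p ℕ.+_) (Eq.sym (ℕP.+-identityʳ p))))

  toList-toVector : ∀ u v → Good (u , v) → Data.Vec.toList (toVector (u , v)) ≡ expand q (u ++ v)
  toList-toVector u v (lu , lv , su , _) = toList-toVecOfLength n _
    (Eq.trans (length-expand q (u ++ v) (length-++-halves u v lu lv)) (Eq.trans (sum-++ u v) su))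

  ++-injective : ∀ (u u' v v' : List ℕ) → length u ≡ length u' → u ++ v ≡ u' ++ v' → (u ≡ u') × (v ≡ v')
  ++-injective [] [] v v' _ e = Eq.refl , e
  ++-injective (a ∷ u) (a' ∷ u') v v' l e with ++-injective u u' v v' (ℕP.suc-injective l) (DLP.∷-injectiveʳ e)
  ... | e₁ , e₂ = Eq.cong₂ _∷_ (DLP.∷-injectiveˡ e) e₁ , e₂

  toVector-injective : ∀ x y → Good x → Good y → toVector x ≡ toVector y → x ≡ y
  toVector-injective (u , v) (u' , v') g@(lu , lv , _) g'@(lu' , lv' , _) e
    with ++-injective u u' v v' (Eq.trans lu (Eq.sym lu'))
           (expand-injective q _ _ (length-++-halves u v lu lv) (length-++-halves u' v' lu' lv')
             (Eq.trans (Eq.sym (toList-toVector u v g)) (Eq.trans (Eq.cong Data.Vec.toList e) (toList-toVector u' v' g'))))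
  ... | Eq.refl , Eq.refl = Eq.refl

  -- q = suc (p' + (suc p' + 0)) definitionally, which FirstZero-expand needs.
  FirstZero-expand-halves : ∀ u v → PositiveHead u → FirstZero (expand q (u ++ v))
  FirstZero-expand-halves (k ∷ u) v h = FirstZero-expand (p' ℕ.+ (suc p' ℕ.+ 0)) k (u ++ v) h

  FirstZero-expand-halves⁻ : ∀ u v → length u ≡ p → FirstZero (expand q (u ++ v)) → PositiveHead u
  FirstZero-expand-halves⁻ (k ∷ u) v _ f = FirstZero-expand⇒positive (p' ℕ.+ (suc p' ℕ.+ 0)) k (u ++ v) f

  toVector-InO : ∀ uv → Good uv → InO F ζ (toVector uv)
  toVector-InO (u , v) g@(lu , lv , _ , hu , d , h) =
    Eq.subst FirstZero (Eq.sym toList≡) (FirstZero-expand-halves u v hu) ,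
    Eq.subst (Sorted (≤-totalOrder q)) (Eq.sym toList≡) (expand-sorted q (u ++ v)) ,
    trans (reflexive (Eq.cong powerSum toList≡))
          (trans (powerSum-expand q (u ++ v) (length-++-halves u v lu lv)) (alternating⇒vanishing u v d lu lv h))
    where
    toList≡ = toList-toVector u v g

  InO⇒toVector : ∀ x → InO F ζ x → Σ Pair λ uv → Good uv × (toVector uv ≡ x)
  InO⇒toVector x (first-zero , sorted , vanishing) with expand-surjective q (Data.Vec.toList x) sorted
  ... | cs , lc , ec = (u , v) , good ,
        Eq.trans (Eq.sym (VP.cast-is-id Eq.refl (toVector (u , v))))
                 (VP.toList-injective Eq.refl (toVector (u , v)) x (Eq.trans (toList-toVector u v good) expand≡))
    where
    u v : List ℕ
    u = take p cs
    v = drop p cs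
    expand≡ : expand q (u ++ v) ≡ Data.Vec.toList x
    expand≡ = Eq.trans (Eq.cong (expand q) (DLP.take++drop≡id p cs)) ec
    lu : length u ≡ p
    lu = Eq.trans (DLP.length-take p cs) (ℕP.m≤n⇒m⊓n≡m (Eq.subst (p ≤_) (Eq.sym lc) (ℕP.m≤m+n p (p ℕ.+ 0))))
    lv : length v ≡ p
    lv = Eq.trans (DLP.length-drop p cs) (Eq.trans (Eq.cong (ℕ._∸ p) lc) (Eq.trans (ℕP.m+n∸m≡n p (p ℕ.+ 0)) (ℕP.+-identityʳ p)))
    su : sum u ℕ.+ sum v ≡ n
    su = Eq.trans (Eq.sym (sum-++ u v)) (Eq.trans (Eq.sym (length-expand q (u ++ v) (length-++-halves u v lu lv)))
                                                  (Eq.trans (Eq.cong length expand≡) (VP.length-toList x)))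
    ev≈0 : ev ζ (map +_ (u ++ v)) ≈ 0#
    ev≈0 = trans (sym (powerSum-expand q (u ++ v) (length-++-halves u v lu lv))) (trans (reflexive (Eq.cong powerSum expand≡)) vanishing)
    good : Good (u , v)
    good = lu , lv , su , FirstZero-expand-halves⁻ u v lu (Eq.subst FirstZero (Eq.sym expand≡) first-zero) ,
           vanishing⇒alternating u v lu lv ev≈0

  InO-card : HasCard {A = Vec (Fin q) n} (λ x → InO F ζ x) (rhs n (suc p'))
  InO-card = HasCard-map toVector Good-card toVector-injective toVector-InO InO⇒toVector

open import Data.Nat using (ℕ; suc; _≤_; _*_)
open import Data.Vec using (Vec)
open import Data.Fin using (Fin)
open import Data.Nat.Divisibility using (_∣_)

mainTheorem11 : ∀ {c ℓ : Level} (F : CharZeroField c ℓ) (ζ : CharZeroField.Carrier F)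
                (n p : ℕ) → 2 ≤ n → Prime p → ¬ (2 ∣ p) →
                IsPrimitiveRoot F (2 * p) ζ →
                HasCard {A = Vec (Fin (2 * p)) n} (λ x → InO F ζ x) (rhs n p)
mainTheorem11 F ζ n (suc p') n≥2 pp odd prim = Correspondence.InO-card F ζ p' n n≥2 pp odd prim
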